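{- Let $\{\Sigma^n\}_{n\ge0}$ be a family of left-regular bands as in the context satisfying axioms (C1), (C2), (C3), (CP), (A1), (A2), (AP), (B1), (B2) of the context. Then $(\mathcal P,\Delta,*)$ is a bialgebra.
   Context: $\mathbb K$ is a field of characteristic $0$. A left-regular band (LRB) is a semigroup $\Sigma$ with $x^2=x$ and $xyx=xy$ for all $x,y$; it is partially ordered by $x\le y\iff xy=y$, and its maximal elements are chambers. Products of LRBs have componentwise product and order. $\{\Sigma^n\}_{n\ge0}$ is a family of LRBs, each $\Sigma^n$ finite and, as a poset, graded of rank $\max\{n-1,0\}$ with unique minimum $\emptyset_n$ (the identity of $\Sigma^n$); $\Sigma^0=\{\emptyset_0\}$, $\Sigma^1=\{\emptyset_1\}$. $\mathcal C^n$ = chambers of $\Sigma^n$; $\deg K=\operatorname{rank}K+1$; $\Sigma^n_K=\{F\in\Sigma^n:K\le F\}$. A composition of $n$ is a finite sequence of positive integers summing to $n$. (C1) For every $F\in\Sigma^n$ there are a composition $(f_1,\dots,f_{\deg F})$ of $n$ and a poset isomorphism $b_F:\Sigma^n_F\to\Sigma^{f_1}\times\cdots\times\Sigma^{f_{\deg F}}$; for $F=\emptyset_n$ the composition is $(n)$ and $b_{\emptyset_n}=\mathrm{id}$. (C2) If $K\le F$ in $\Sigma^n$, $m=\deg K$, $b_K:\Sigma^n_K\to\Sigma^{k_1}\times\cdots\times\Sigma^{k_m}$, $b_K(F)=F_1\times\cdots\times F_m$, then (restricting $b_K$ to $\Sigma^n_F\to\prod\Sigma^{k_i}_{F_i}$)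 $b_F=(b_{F_1}\times\cdots\times b_{F_m})\circ b_K$ and the composition attached to $F$ is the concatenation of those of $F_1,\dots,F_m$. (C3) Every rank-2 $H\in\Sigma^n$ lies above exactly two rank-1 elements, labellable $K,G$ so that $b_K:\Sigma^n_K\to\Sigma^{k_1}\times\Sigma^{k_2}$ maps $H$ to $\emptyset_{k_1}\times K'$ and $b_G:\Sigma^n_G\to\Sigma^{g_1}\times\Sigma^{g_2}$ maps $H$ to $G'\times\emptyset_{g_2}$ for some rank-1 $K'\in\Sigma^{k_2},G'\in\Sigma^{g_1}$. (CP) For $F\le H,F\le N$: $b_F(HN)=b_F(H)b_F(N)$. (A1) For every composition $(f_1,\dots,f_k)$ of $n$ there are $F\in\Sigma^n$ of degree $k$ and a poset isomorphism $j_F:\Sigma^{f_1}\times\cdots\times\Sigma^{f_k}\to\Sigma^n_F$; distinct compositions give distinct $F$; $(n)$ gives $F=\emptyset_n$, $j_F=\mathrm{id}$. A sequence of nonnegative integers summing to $n$ is identified with the composition obtained by deleting zeros, and $j_F$ also denotes $j_F$ precomposed with the projection deleting the one-point factors $\Sigma^0$. (A2) For a composition $(g_1,\dots,g_m)$ of $n$ with attached $G$ and compositions of the $g_i$ with attached $F_i\in\Sigma^{g_i}$, the element $F$ attached to the concatenation satisfies $F=j_G(F_1\times\cdots\times F_m)$ and $j_F=j_G\circ(j_{F_1}\times\cdots\times j_{F_m})$. (AP) For $F\le H,F\le N$: $j_F^{ -1}(HN)=j_F^{ -1}(H)j_F^{ -1}(N)$. $G_{a,b}\in\Sigma^{a+b}$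 denotes the element attached by (A1) to $(a,b)$, $a,b\ge0$. $b^n:\Sigma^n\to\Sigma^0\times\Sigma^n$, $F\mapsto\emptyset_0\times F$; $B^n:\Sigma^n\to\Sigma^n\times\Sigma^0$, $F\mapsto F\times\emptyset_0$. $T^n=\{b_K:\operatorname{rank}K=1\}\cup\{b^n,B^n\}$ ($n\ge1$), $T^0=\{b^0\}$. For $f\in T^n$: $K_f=K$ if $f=b_K$, else $K_f=\emptyset_n$ ($f$ is a poset isomorphism $\Sigma^n_{K_f}\to\Sigma^{n_1}\times\Sigma^{n_2}$, $n_1+n_2=n$); $\hat f(P)=f(K_fP)$; $T^n_F=\{f\in T^n:K_f\le F\}$. (B1) For all $n,m\ge0$ there is a bijection $g_{n,m}:T^n\times T^m\to T^{n+m}$ such that for $f:\Sigma^n_{K_f}\to\Sigma^{n_1}\times\Sigma^{n_2}$, $f':\Sigma^m_{K_{f'}}\to\Sigma^{m_1}\times\Sigma^{m_2}$, $f''=g_{n,m}(f,f')$ is the unique element of $T^{n+m}$ with image $\Sigma^{n_1+m_1}\times\Sigma^{n_2+m_2}$ and $G_{n,m}K_{f''}=j_{G_{n,m}}(K_f\times K_{f'})$. (B2) For such $f,f',f''$ and all $P\in\Sigma^n,P'\in\Sigma^m$ with $\hat f(P)=P_1\times P_2$, $\hat{f'}(P')=P'_1\times P'_2$: $\hat{f''}(j_{G_{n,m}}(P\times P'))=j_{G_{n_1,m_1}}(P_1\times P'_1)\times j_{G_{n_2,m_2}}(P_2\times P'_2)$. $\mathcal P=\bigoplus_{n\ge0}\mathbb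 K(\Sigma^n)^*$ with basis $M_F$ ($F\in\Sigma^n$), $M_{\emptyset_0}=1$. Coproduct: $\Delta(1)=1\otimes1$ and for $n\ge1$, $\Delta M_F=1\otimes M_F+M_F\otimes1+\sum_{K\le F,\operatorname{rank}K=1}M_{F_1}\otimes M_{F_2}$ where $b_K(F)=F_1\times F_2$. Counit: $\varepsilon(1)=1$, $\varepsilon=0$ in positive degree. Product: $1$ is the unit and for $F_1\in\Sigma^{g_1},F_2\in\Sigma^{g_2}$, $M_{F_1}*M_{F_2}=\sum_{F\in\Sigma^{g_1+g_2}:GF=j_G(F_1\times F_2)}M_F$ with $G=G_{g_1,g_2}$. -}

module Defs where

open import Level using (Level; _⊔_) renaming (suc to lsuc; zero to lzero)
open import Data.Nat using (ℕ; zero; suc; _+_; _∸_; _≤_; _<_)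
import Data.Nat as ℕ
open import Data.Nat.Properties using () renaming (_≟_ to _≟ℕ_)
open import Data.Product using (Σ; ∃; ∃-syntax; _×_; _,_; proj₁; proj₂)
open import Data.Product.Properties using (≡-dec)
open import Data.Sum using (_⊎_)
open import Data.List using (List; []; _∷_; [_]; map; concat; concatMap; zipWith; length; filter; foldr)
open import Data.Nat.ListAction using (sum)
open import Data.List.Relation.Unary.All using (All)
open import Data.List.Relation.Unary.Unique.Propositional using (Unique)
open import Data.List.Membership.Propositional using (_∈_)
open import Data.List.Relation.Binary.Pointwise using (Pointwise)
open import Relation.Binary.PropositionalEquality using (_≡_; _≢_; refl)
open import Relation.Binary.Definitions using (DecidableEquality)
open import Relation.Nullary using (¬_; Dec; yes; no)
open import Relation.Nullary.Decidable using (_×-dec_; ¬?)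
open import Function.Bundles using (_⤖_; _⇔_; Bijection)
open import Algebra.Bundles using (CommutativeRing)

natK : ∀ {c ℓ} (R : CommutativeRing c ℓ) → ℕ → CommutativeRing.Carrier R
natK R zero    = CommutativeRing.0# R
natK R (suc n) = CommutativeRing._+_ R (CommutativeRing.1# R) (natK R n)

record Char0Field (c ℓ : Level) : Set (lsuc (c ⊔ ℓ)) where
  field
    cring : CommutativeRing c ℓ
  open CommutativeRing cring public
  field
    1≉0     : ¬ (1# ≈ 0#)
    inverse : ∀ x → ¬ (x ≈ 0#) → ∃[ y ] (x * y ≈ 1#)
    char0   : ∀ n → ¬ (natK cring (suc n) ≈ 0#)

-- The data of a family {Σ^n} (the Σ^n are written S n).
--   comp F      : the composition (f_1,…,f_deg F) attached to F by (C1)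
--   b F G       : b_F(G), an element of Σ^{f_1}×⋯×Σ^{f_k}, encoded as the
--                 list [(f_1,G_1),…,(f_k,G_k)] of dependent pairs
--                 (b F is only meaningful on Σ^n_F; its values elsewhere
--                 are irrelevant)
--   att n c     : the element F ∈ Σ^n attached to the composition c by (A1)
--   j n c xs    : j_F(xs) for F = att n c, xs encoded as above

record LRBData : Set₁ where
  field
    S     : ℕ → Set
    _≟_   : ∀ {n} → DecidableEquality (S n)
    elems : (n : ℕ) → List (S n)
    _·_   : ∀ {n} → S n → S n → S n
    ∅     : (n : ℕ) → S n
    rank  : ∀ {n} → S n → ℕ
    comp  : ∀ {n} → S n → List ℕ
    b     : ∀ {n} → S n → S n → List (Σ ℕ S)
    att   : (n : ℕ) → List ℕ → S n
    j     : (n : ℕ) → List ℕ → List (Σ ℕ S) → S n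
  infixl 7 _·_

module Ops (D : LRBData) where
  open LRBData D

  ES : Set
  ES = Σ ℕ S

  _≟ES_ : DecidableEquality ES
  _≟ES_ = ≡-dec _≟ℕ_ _≟_

  _≼_ : ∀ {n} → S n → S n → Set
  x ≼ y = x · y ≡ y

  _≼?_ : ∀ {n} → (x y : S n) → Dec (x ≼ y)
  x ≼? y = (x · y) ≟ y

  _≺_ : ∀ {n} → S n → S n → Set
  x ≺ y = x ≼ y × x ≢ y

  _⋖_ : ∀ {n} → S n → S n → Set
  x ⋖ y = x ≺ y × (∀ z → x ≺ z → z ≺ y → ⊥′)
    where open import Data.Empty renaming (⊥ to ⊥′)

  IsChamber : ∀ {n} → S n → Set
  IsChamber x = ∀ y → x ≼ y → x ≡ y

  deg : ∀ {n} → S n → ℕ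
  deg F = suc (rank F)

  shape : List ES → List ℕ
  shape = map proj₁

  IsComposition : ℕ → List ℕ → Set
  IsComposition n c = All (λ k → 1 ≤ k) c × sum c ≡ n

  _≼*_ : List ES → List ES → Set
  _≼*_ = Pointwise (λ x y → Σ (proj₁ x ≡ proj₁ y) (λ { refl → proj₂ x ≼ proj₂ y }))

  mulES : ES → ES → ES
  mulES (k , x) (k′ , y) with k ≟ℕ k′
  ... | yes refl = (k , x · y)
  ... | no _     = (k , x)

  _·*_ : List ES → List ES → List ES
  _·*_ = zipWith mulES

  bES : ES → ES → List ES
  bES (k , x) (k′ , y) with k ≟ℕ k′
  ... | yes refl = b x y
  ... | no _     = []

  compES : ES → List ℕ
  compES (k , x) = comp x

  -- deleting zeros / one-point factors Σ^0
  nz : List ℕ → List ℕ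
  nz = filter (λ k → ¬? (k ≟ℕ 0))

  dropZ : List ES → List ES
  dropZ = filter (λ x → ¬? (proj₁ x ≟ℕ 0))

  Gab : (a b′ : ℕ) → S (a + b′)
  Gab a b′ = att (a + b′) (nz (a ∷ b′ ∷ []))

  jPair : ES → ES → ES
  jPair (a , x) (b′ , y) = (a + b′ , j (a + b′) (nz (a ∷ b′ ∷ [])) (dropZ ((a , x) ∷ (b′ , y) ∷ [])))

  toPair : List ES → ES × ES
  toPair (x ∷ y ∷ _) = (x , y)
  toPair _ = ((0 , ∅ 0) , (0 , ∅ 0))

  toPairℕ : List ℕ → ℕ × ℕ
  toPairℕ (x ∷ y ∷ _) = (x , y)
  toPairℕ _ = (0 , 0)

record Axioms (D : LRBData) : Set where
  open LRBData D
  open Ops D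
  field
    elems-complete : ∀ {n} (x : S n) → x ∈ elems n
    elems-unique   : ∀ n → Unique (elems n)
    ·-assoc : ∀ {n} (x y z : S n) → (x · y) · z ≡ x · (y · z)
    ·-idem  : ∀ {n} (x : S n) → x · x ≡ x
    ·-lrb   : ∀ {n} (x y : S n) → x · y · x ≡ x · y
    ∅-idˡ   : ∀ {n} (x : S n) → ∅ n · x ≡ x
    ∅-idʳ   : ∀ {n} (x : S n) → x · ∅ n ≡ x
    rank-∅     : ∀ n → rank (∅ n) ≡ 0
    rank-cover : ∀ {n} (x y : S n) → x ⋖ y → rank y ≡ suc (rank x)
    rank-chamber : ∀ {n} (x : S n) → IsChamber x → rank x ≡ n ∸ 1
    Σ⁰-single : ∀ (x : S 0) → x ≡ ∅ 0
    Σ¹-single : ∀ (x : S 1) → x ≡ ∅ 1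

    comp-isComp : ∀ {n} (F : S (suc n)) → IsComposition (suc n) (comp F)
    comp-length : ∀ {n} (F : S n) → length (comp F) ≡ deg F
    b-shape : ∀ {n} (F G : S n) → F ≼ G → shape (b F G) ≡ comp F
    b-inj   : ∀ {n} (F G G′ : S n) → F ≼ G → F ≼ G′ → b F G ≡ b F G′ → G ≡ G′
    b-surj  : ∀ {n} (F : S n) (xs : List ES) → shape xs ≡ comp F →
              ∃[ G ] (F ≼ G × b F G ≡ xs)
    b-order : ∀ {n} (F G G′ : S n) → F ≼ G → F ≼ G′ → (G ≼ G′ ⇔ (b F G ≼* b F G′))
    comp-∅  : ∀ n → comp (∅ n) ≡ [ n ]
    b-∅     : ∀ n (G : S n) → b (∅ n) G ≡ [ (n , G) ]
    C2-comp : ∀ {n} (K F : S n) → K ≼ F →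
              comp F ≡ concatMap compES (b K F)
    C2-b    : ∀ {n} (K F G : S n) → K ≼ F → F ≼ G →
              b F G ≡ concat (zipWith bES (b K F) (b K G))
    C3 : ∀ {n} (H : S n) → rank H ≡ 2 →
         ∃[ K ] ∃[ G ] (rank K ≡ 1 × rank G ≡ 1 × K ≼ H × G ≼ H × K ≢ G
           × (∀ L → rank L ≡ 1 → L ≼ H → L ≡ K ⊎ L ≡ G)
           × (∃[ k₁ ] ∃[ k₂ ] Σ (S k₂) λ K′ → rank K′ ≡ 1 ×
                b K H ≡ (k₁ , ∅ k₁) ∷ (k₂ , K′) ∷ [])
           × (∃[ g₁ ] ∃[ g₂ ] Σ (S g₁) λ G′ → rank G′ ≡ 1 ×
                b G H ≡ (g₁ , G′) ∷ (g₂ , ∅ g₂) ∷ []))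
    CP : ∀ {n} (F H N : S n) → F ≼ H → F ≼ N → b F (H · N) ≡ (b F H ·* b F N)

    att-deg   : ∀ n c → IsComposition (suc n) c → length c ≡ deg (att (suc n) c)
    j-above   : ∀ n c → IsComposition n c → ∀ xs → shape xs ≡ c → att n c ≼ j n c xs
    j-inj     : ∀ n c → IsComposition n c → ∀ xs ys → shape xs ≡ c → shape ys ≡ c →
                j n c xs ≡ j n c ys → xs ≡ ys
    j-surj    : ∀ n c → IsComposition n c → ∀ G → att n c ≼ G →
                ∃[ xs ] (shape xs ≡ c × j n c xs ≡ G)
    j-order   : ∀ n c → IsComposition n c → ∀ xs ys → shape xs ≡ c → shape ys ≡ c →
                (xs ≼* ys ⇔ (j n c xs ≼ j n c ys))
    att-inj   : ∀ n c c′ → IsComposition n c → IsComposition n c′ → att n c ≡ att n c′ → c ≡ c′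
    att-triv  : ∀ n → att n (nz [ n ]) ≡ ∅ n
    j-triv    : ∀ n (x : S n) → j n (nz [ n ]) (dropZ [ (n , x) ]) ≡ x
    -- (A2): blocks = [(g_1,c_1),…,(g_m,c_m)], c_i a composition of g_i
    A2-att : ∀ n (blocks : List (ℕ × List ℕ)) →
             IsComposition n (map proj₁ blocks) →
             All (λ gc → IsComposition (proj₁ gc) (proj₂ gc)) blocks →
             att n (concatMap proj₂ blocks)
               ≡ j n (map proj₁ blocks) (map (λ gc → (proj₁ gc , att (proj₁ gc) (proj₂ gc))) blocks)
    A2-j   : ∀ n (blocks : List (ℕ × List ℕ)) →
             IsComposition n (map proj₁ blocks) →
             All (λ gc → IsComposition (proj₁ gc) (proj₂ gc)) blocks →
             ∀ (yss : List (List ES)) →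
             Pointwise (λ gc ys → shape ys ≡ proj₂ gc) blocks yss →
             j n (concatMap proj₂ blocks) (concat yss)
               ≡ j n (map proj₁ blocks)
                     (zipWith (λ gc ys → (proj₁ gc , j (proj₁ gc) (proj₂ gc) ys)) blocks yss)
    AP : ∀ n c → IsComposition n c → ∀ xs ys → shape xs ≡ c → shape ys ≡ c →
         j n c (xs ·* ys) ≡ j n c xs · j n c ys

module TDefs (D : LRBData) where
  open LRBData D
  open Ops D

  -- T^n = {b_K : rank K = 1} ∪ {b^n, B^n}  (B^n only for n ≥ 1, since B^0 = b^0)
  data T (n : ℕ) : Set where
    tK : (K : S n) → rank K ≡ 1 → T n
    tb : T n
    tB : 1 ≤ n → T n

  K_ : ∀ {n} → T n → S n
  K_ (tK K _) = K
  K_ {n} tb     = ∅ n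
  K_ {n} (tB _) = ∅ n

  -- f : Σ^n_{K_f} → Σ^{n₁} × Σ^{n₂};  dims f = (n₁ , n₂)
  dims : ∀ {n} → T n → ℕ × ℕ
  dims (tK K _) = toPairℕ (comp K)
  dims {n} tb     = (0 , n)
  dims {n} (tB _) = (n , 0)

  -- f̂(P) = f(K_f P)
  hat : ∀ {n} → T n → S n → ES × ES
  hat (tK K _) P = toPair (b K (K · P))
  hat {n} tb P     = ((0 , ∅ 0) , (n , P))
  hat {n} (tB _) P = ((n , P) , (0 , ∅ 0))

  app : ∀ {n m} → (T n × T m) ⤖ T (n + m) → T n → T m → T (n + m)
  app g f f′ = Bijection.to g (f , f′)

record BAxioms (D : LRBData) : Set where
  open LRBData D
  open Ops D
  open TDefs D
  field
    g : ∀ n m → (T n × T m) ⤖ T (n + m)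
    B1-dims : ∀ n m (f : T n) (f′ : T m) →
              dims (app (g n m) f f′) ≡ (proj₁ (dims f) + proj₁ (dims f′) , proj₂ (dims f) + proj₂ (dims f′))
    B1-K    : ∀ n m (f : T n) (f′ : T m) →
              (n + m , Gab n m · K_ (app (g n m) f f′)) ≡ jPair (n , K_ f) (m , K_ f′)
    B1-unique : ∀ n m (f : T n) (f′ : T m) (h : T (n + m)) →
              dims h ≡ (proj₁ (dims f) + proj₁ (dims f′) , proj₂ (dims f) + proj₂ (dims f′)) →
              (n + m , Gab n m · K_ h) ≡ jPair (n , K_ f) (m , K_ f′) →
              h ≡ app (g n m) f f′
    B2 : ∀ n m (f : T n) (f′ : T m) (P : S n) (P′ : S m) →
         hat (app (g n m) f f′) (proj₂ (jPair (n , P) (m , P′)))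
           ≡ (jPair (proj₁ (hat f P)) (proj₁ (hat f′ P′)) ,
              jPair (proj₂ (hat f P)) (proj₂ (hat f′ P′)))

-- The bialgebra P = ⊕_n 𝕂(Σ^n)^* on the basis M_F, F ∈ ES.
-- Elements of P (resp. P⊗P, P⊗P⊗P) are finite formal 𝕂-linear
-- combinations of basis elements M_F (resp. M_F⊗M_G, M_F⊗M_G⊗M_H),
-- compared coefficientwise.

module Hopf {c ℓ : Level} (𝕂 : Char0Field c ℓ) (D : LRBData) where
  open Char0Field 𝕂 renaming (_+_ to _+ₖ_; _*_ to _*ₖ_)
  open LRBData D
  open Ops D

  V₁ V₂ V₃ : Set c
  V₁ = List (Carrier × ES)
  V₂ = List (Carrier × ES × ES)
  V₃ = List (Carrier × ES × ES × ES)

  δ : ES → ES → Carrier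
  δ x y with x ≟ES y
  ... | yes _ = 1#
  ... | no _  = 0#

  coeff₁ : V₁ → ES → Carrier
  coeff₁ v F = foldr (λ { (a , G) r → a *ₖ δ G F +ₖ r }) 0# v

  coeff₂ : V₂ → ES → ES → Carrier
  coeff₂ v F F′ = foldr (λ { (a , G , G′) r → a *ₖ δ G F *ₖ δ G′ F′ +ₖ r }) 0# v

  coeff₃ : V₃ → ES → ES → ES → Carrier
  coeff₃ v F F′ F″ = foldr (λ { (a , G , G′ , G″) r → a *ₖ δ G F *ₖ δ G′ F′ *ₖ δ G″ F″ +ₖ r }) 0# v

  _≈₁_ : V₁ → V₁ → Set ℓ
  v ≈₁ w = ∀ F → coeff₁ v F ≈ coeff₁ w F

  _≈₂_ : V₂ → V₂ → Set ℓ
  v ≈₂ w = ∀ F F′ → coeff₂ v F F′ ≈ coeff₂ w F F′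

  _≈₃_ : V₃ → V₃ → Set ℓ
  v ≈₃ w = ∀ F F′ F″ → coeff₃ v F F′ F″ ≈ coeff₃ w F F′ F″

  one : ES
  one = (0 , ∅ 0)

  one₁ : V₁
  one₁ = [ (1# , one) ]

  one₂ : V₂
  one₂ = [ (1# , one , one) ]

  basisMul : ES → ES → List ES
  basisMul (zero , _)  (g₂ , F₂) = [ (g₂ , F₂) ]
  basisMul (suc g₁ , F₁) (zero , _) = [ (suc g₁ , F₁) ]
  basisMul (suc g₁ , F₁) (suc g₂ , F₂) =
    map (λ F → (suc g₁ + suc g₂ , F))
        (filter (λ F → (Gab (suc g₁) (suc g₂) · F) ≟ proj₂ (jPair (suc g₁ , F₁) (suc g₂ , F₂)))
                (elems (suc g₁ + suc g₂)))

  basisΔ : ES → List (ES × ES)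
  basisΔ (zero , _) = [ (one , one) ]
  basisΔ (suc n , F) =
    (one , (suc n , F)) ∷ ((suc n , F) , one) ∷
    map (λ K → toPair (b K F))
        (filter (λ K → (rank K ≟ℕ 1) ×-dec (K ≼? F)) (elems (suc n)))

  basisε : ES → Carrier
  basisε (zero , _)  = 1#
  basisε (suc _ , _) = 0#

  mul : V₁ → V₁ → V₁
  mul v w = concatMap (λ { (a , F) → concatMap (λ { (a′ , F′) →
              map (λ H → (a *ₖ a′ , H)) (basisMul F F′) }) w }) v

  mul₂ : V₂ → V₂ → V₂
  mul₂ v w = concatMap (λ { (a , F , G) → concatMap (λ { (a′ , F′ , G′) →
               concatMap (λ H → map (λ H′ → (a *ₖ a′ , H , H′)) (basisMul G G′))
                         (basisMul F F′) }) w }) v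

  Δ : V₁ → V₂
  Δ v = concatMap (λ { (a , F) → map (λ { (F₁ , F₂) → (a , F₁ , F₂) }) (basisΔ F) }) v

  ε : V₁ → Carrier
  ε v = foldr (λ { (a , F) r → a *ₖ basisε F +ₖ r }) 0# v

  Δ⊗id : V₂ → V₃
  Δ⊗id v = concatMap (λ { (a , F , G) → map (λ { (F₁ , F₂) → (a , F₁ , F₂ , G) }) (basisΔ F) }) v

  id⊗Δ : V₂ → V₃
  id⊗Δ v = concatMap (λ { (a , F , G) → map (λ { (G₁ , G₂) → (a , F , G₁ , G₂) }) (basisΔ G) }) v

  ε⊗id : V₂ → V₁
  ε⊗id v = map (λ { (a , F , G) → (a *ₖ basisε F , G) }) v

  id⊗ε : V₂ → V₁
  id⊗ε v = map (λ { (a , F , G) → (a *ₖ basisε G , F) }) v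

  record IsBialgebra : Set (c ⊔ ℓ) where
    field
      mul-assoc  : ∀ u v w → mul (mul u v) w ≈₁ mul u (mul v w)
      mul-unitˡ  : ∀ v → mul one₁ v ≈₁ v
      mul-unitʳ  : ∀ v → mul v one₁ ≈₁ v
      Δ-coassoc  : ∀ v → Δ⊗id (Δ v) ≈₃ id⊗Δ (Δ v)
      ε-counitˡ  : ∀ v → ε⊗id (Δ v) ≈₁ v
      ε-counitʳ  : ∀ v → id⊗ε (Δ v) ≈₁ v
      Δ-mul      : ∀ v w → Δ (mul v w) ≈₂ mul₂ (Δ v) (Δ w)
      Δ-one      : Δ one₁ ≈₂ one₂
      ε-mul      : ∀ v w → ε (mul v w) ≈ ε v *ₖ ε w
      ε-one      : ε one₁ ≈ 1#

-- All bialgebra axioms are multilinear, so they reduce to identities between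
-- coefficients of basis elements. Each coefficient is a finite sum of Kronecker
-- deltas, and each basis identity becomes a bijection between index sets: for
-- associativity by (A2) and (AP), for coassociativity by (C2) and (C3), and for
-- the compatibility of Δ with * by (B1), (B2) and (CP).

module Submission where

open import Level using (Level)
open import Data.Nat as ℕ using (ℕ; zero; suc; _+_; _≤_; _<_; s≤s; z≤n)
import Data.Nat.Properties as ℕ
open import Data.Product using (∃; ∃-syntax; _×_; _,_; proj₁; proj₂)
open import Data.Product.Properties using (≡-dec)
open import Data.Sum using (_⊎_; inj₁; inj₂)
open import Data.List using (List; []; _∷_; [_]; map; concat; concatMap; zipWith; length; filter; _++_)
open import Data.List.Membership.Propositional using (_∈_; _∉_; find; lose)
open import Data.List.Membership.Propositional.Properties
  using (∈-map⁺; ∈-map⁻; ∈-++⁺ˡ; ∈-++⁺ʳ; ∈-++⁻; ∈-filter⁺; ∈-filter⁻; ∈-concatMap⁺; ∈-concatMap⁻)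
open import Data.List.Relation.Unary.Any as Any using (here; there; any?)
open import Data.List.Relation.Unary.All as All using (All; []; _∷_)
open import Data.List.Relation.Unary.AllPairs using ([]; _∷_)
open import Data.List.Relation.Unary.Unique.Propositional using (Unique)
import Data.List.Relation.Unary.Unique.Propositional.Properties as Unique
open import Data.List.Relation.Binary.Pointwise using ([]; _∷_)
open import Data.List.Properties using (∷-injectiveˡ; ∷-injectiveʳ; length-map; ++-identityʳ)
import Data.List.Properties
import Relation.Binary.PropositionalEquality as ≡
open ≡ using (_≡_; _≢_)
open import Relation.Binary.Definitions using (DecidableEquality)
open import Relation.Nullary using (¬_; Dec; yes; no)
open import Relation.Nullary.Decidable using (_×-dec_; ¬?)
open import Relation.Unary using (Pred; Decidable)
open import Data.Empty using (⊥; ⊥-elim)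
open import Function using (_∘_)
open import Function.Bundles using (Equivalence; Bijection)
open import Algebra.Bundles using (CommutativeRing)
open import Defs

module ListSum {c ℓ} (R : CommutativeRing c ℓ) where
  open CommutativeRing R renaming (_+_ to _+ₖ_; _*_ to _*ₖ_)
  open import Relation.Binary.Reasoning.Setoid setoid
  open import Algebra.Properties.CommutativeSemigroup +-commutativeSemigroup using (interchange)

  private variable
    a b : Level
    A : Set a
    B : Set b

  sumL : (A → Carrier) → List A → Carrier
  sumL f []       = 0#
  sumL f (x ∷ xs) = f x +ₖ sumL f xs

  indicator : ∀ {p} {P : Set p} → Dec P → Carrier
  indicator (yes _) = 1#
  indicator (no _)  = 0#

  indicator-yes : ∀ {p} {P : Set p} (d : Dec P) → P → indicator d ≈ 1#
  indicator-yes (yes _) _ = refl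
  indicator-yes (no ¬p) p = ⊥-elim (¬p p)

  indicator-no : ∀ {p} {P : Set p} (d : Dec P) → ¬ P → indicator d ≈ 0#
  indicator-no (yes p) ¬p = ⊥-elim (¬p p)
  indicator-no (no _)  _  = refl

  sumL-cong-∈ : ∀ {f g : A → Carrier} xs → (∀ x → x ∈ xs → f x ≈ g x) → sumL f xs ≈ sumL g xs
  sumL-cong-∈ []       h = refl
  sumL-cong-∈ (x ∷ xs) h = +-cong (h x (here ≡.refl)) (sumL-cong-∈ xs (λ y m → h y (there m)))

  sumL-cong : ∀ {f g : A → Carrier} xs → (∀ x → f x ≈ g x) → sumL f xs ≈ sumL g xs
  sumL-cong xs h = sumL-cong-∈ xs (λ x _ → h x)

  sumL-zero : ∀ (f : A → Carrier) xs → (∀ x → x ∈ xs → f x ≈ 0#) → sumL f xs ≈ 0#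
  sumL-zero f []       h = refl
  sumL-zero f (x ∷ xs) h = trans (+-cong (h x (here ≡.refl)) (sumL-zero f xs (λ y m → h y (there m)))) (+-identityˡ _)

  sumL-++ : ∀ (f : A → Carrier) xs ys → sumL f (xs ++ ys) ≈ sumL f xs +ₖ sumL f ys
  sumL-++ f []       ys = sym (+-identityˡ _)
  sumL-++ f (x ∷ xs) ys = trans (+-congˡ (sumL-++ f xs ys)) (sym (+-assoc _ _ _))

  sumL-+ : ∀ (f g : A → Carrier) xs → sumL (λ x → f x +ₖ g x) xs ≈ sumL f xs +ₖ sumL g xs
  sumL-+ f g []       = sym (+-identityˡ _)
  sumL-+ f g (x ∷ xs) = trans (+-congˡ (sumL-+ f g xs)) (interchange _ _ _ _)

  sumL-*ˡ : ∀ k (f : A → Carrier) xs → k *ₖ sumL f xs ≈ sumL (λ x → k *ₖ f x) xs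
  sumL-*ˡ k f []       = zeroʳ k
  sumL-*ˡ k f (x ∷ xs) = trans (distribˡ k _ _) (+-congˡ (sumL-*ˡ k f xs))

  sumL-*ʳ : ∀ k (f : A → Carrier) xs → sumL f xs *ₖ k ≈ sumL (λ x → f x *ₖ k) xs
  sumL-*ʳ k f xs = trans (*-comm _ _) (trans (sumL-*ˡ k f xs) (sumL-cong xs (λ x → *-comm _ _)))

  sumL-map : ∀ (f : B → Carrier) (g : A → B) xs → sumL f (map g xs) ≡ sumL (f ∘ g) xs
  sumL-map f g []       = ≡.refl
  sumL-map f g (x ∷ xs) = ≡.cong (f (g x) +ₖ_) (sumL-map f g xs)

  sumL-concatMap : ∀ (f : B → Carrier) (g : A → List B) xs →
                   sumL f (concatMap g xs) ≈ sumL (λ x → sumL f (g x)) xs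
  sumL-concatMap f g []       = refl
  sumL-concatMap f g (x ∷ xs) = trans (sumL-++ f (g x) (concatMap g xs)) (+-congˡ (sumL-concatMap f g xs))

  sumL-swap : ∀ (f : A → B → Carrier) xs ys →
              sumL (λ x → sumL (f x) ys) xs ≈ sumL (λ y → sumL (λ x → f x y) xs) ys
  sumL-swap f []       ys = sym (sumL-zero _ ys (λ _ _ → refl))
  sumL-swap f (x ∷ xs) ys = trans (+-congˡ (sumL-swap f xs ys)) (sym (sumL-+ (f x) _ ys))

  sumL-filter : ∀ {p} {P : Pred A p} (P? : Decidable P) (f : A → Carrier) xs →
                sumL f (filter P? xs) ≈ sumL (λ x → indicator (P? x) *ₖ f x) xs
  sumL-filter P? f [] = refl
  sumL-filter P? f (x ∷ xs) with P? x
  ... | yes _ = +-cong (sym (*-identityˡ _)) (sumL-filter P? f xs)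
  ... | no _  = trans (sumL-filter P? f xs) (trans (sym (+-identityˡ _)) (+-congʳ (sym (zeroˡ _))))

  sumL-*-sumL : ∀ k (xs : List A) (g : A → List B) (f : A → B → Carrier) →
                sumL (λ x → sumL (λ y → k *ₖ f x y) (g x)) xs ≈ k *ₖ sumL (λ x → sumL (f x) (g x)) xs
  sumL-*-sumL k xs g f = begin
    sumL (λ x → sumL (λ y → k *ₖ f x y) (g x)) xs ≈⟨ sumL-cong xs (λ x → sym (sumL-*ˡ k (f x) (g x))) ⟩
    sumL (λ x → k *ₖ sumL (f x) (g x)) xs         ≈⟨ sym (sumL-*ˡ k _ xs) ⟩
    k *ₖ sumL (λ x → sumL (f x) (g x)) xs         ∎

  sumL-single : ∀ (f : A → Carrier) xs x₀ → Unique xs → x₀ ∈ xs →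
                (∀ x → x ∈ xs → x ≢ x₀ → f x ≈ 0#) → sumL f xs ≈ f x₀
  sumL-single f (x ∷ xs) x₀ (x∉ ∷ u) (here ≡.refl) h =
    trans (+-congˡ (sumL-zero f xs (λ y m → h y (there m) (λ eq → All.lookup x∉ m (≡.sym eq))))) (+-identityʳ _)
  sumL-single f (x ∷ xs) x₀ (x∉ ∷ u) (there m) h =
    trans (+-congʳ (h x (here ≡.refl) (λ eq → All.lookup x∉ m eq)))
      (trans (+-identityˡ _) (sumL-single f xs x₀ u m (λ y m′ → h y (there m′))))

  module _ (_≟_ : DecidableEquality A) where

    δ : A → A → Carrier
    δ x y = indicator (x ≟ y)

    δ-refl : ∀ x → δ x x ≈ 1#
    δ-refl x = indicator-yes (x ≟ x) ≡.refl

    δ-≢ : ∀ {x y} → x ≢ y → δ x y ≈ 0#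
    δ-≢ {x} {y} = indicator-no (x ≟ y)

    sumL-δ-∈ : ∀ xs x → Unique xs → x ∈ xs → sumL (λ y → δ y x) xs ≈ 1#
    sumL-δ-∈ xs x u m = trans (sumL-single _ xs x u m (λ y _ → δ-≢)) (δ-refl x)

    sumL-δ-∉ : ∀ xs x → x ∉ xs → sumL (λ y → δ y x) xs ≈ 0#
    sumL-δ-∉ xs x x∉ = sumL-zero _ xs (λ y m → δ-≢ (λ { ≡.refl → x∉ m }))

    sumL-sumL-δ-unique : ∀ (L : List B) (M : B → List A) x → Unique L → (∀ Y → Unique (M Y)) →
                         ∀ Y₀ → Y₀ ∈ L → x ∈ M Y₀ → (∀ Y → Y ∈ L → x ∈ M Y → Y ≡ Y₀) →
                         sumL (λ Y → sumL (λ Z → δ Z x) (M Y)) L ≈ 1#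
    sumL-sumL-δ-unique L M x uL uM Y₀ Y₀∈ x∈ unique =
      trans (sumL-single _ L Y₀ uL Y₀∈ (λ Y Y∈ Y≢Y₀ → sumL-δ-∉ (M Y) x (λ x∈′ → Y≢Y₀ (unique Y Y∈ x∈′))))
            (sumL-δ-∈ (M Y₀) x (uM Y₀) x∈)

    sumL-sumL-δ-none : ∀ (L : List B) (M : B → List A) x → (∀ Y → Y ∈ L → x ∉ M Y) →
                       sumL (λ Y → sumL (λ Z → δ Z x) (M Y)) L ≈ 0#
    sumL-sumL-δ-none L M x none = sumL-zero _ L (λ Y Y∈ → sumL-δ-∉ (M Y) x (none Y Y∈))

    -- Both sides equal the double sum over i ∈ I, y ∈ M of δ (σ i) y ψ y.
    sumL-bijection : ∀ (ψ : A → Carrier) {I : List B} {M : List A} (σ : B → A) →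
                     Unique I → Unique M →
                     (∀ i → i ∈ I → σ i ∈ M) →
                     (∀ y → y ∈ M → ∃[ i ] (i ∈ I × σ i ≡ y)) →
                     (∀ i i′ → i ∈ I → i′ ∈ I → σ i ≡ σ i′ → i ≡ i′) →
                     sumL (ψ ∘ σ) I ≈ sumL ψ M
    sumL-bijection ψ {I} {M} σ uI uM into onto inj = begin
      sumL (ψ ∘ σ) I                                   ≈⟨ sumL-cong-∈ I (λ i m → sym (pick-σ i m)) ⟩
      sumL (λ i → sumL (λ y → δ (σ i) y *ₖ ψ y) M) I    ≈⟨ sumL-swap (λ i y → δ (σ i) y *ₖ ψ y) I M ⟩
      sumL (λ y → sumL (λ i → δ (σ i) y *ₖ ψ y) I) M    ≈⟨ sumL-cong-∈ M pick-preimage ⟩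
      sumL ψ M                                         ∎
      where
      δ*-refl : ∀ y → δ y y *ₖ ψ y ≈ ψ y
      δ*-refl y = trans (*-congʳ (δ-refl y)) (*-identityˡ _)

      δ*-≢ : ∀ {x y} → x ≢ y → δ x y *ₖ ψ y ≈ 0#
      δ*-≢ ne = trans (*-congʳ (δ-≢ ne)) (zeroˡ _)

      pick-σ : ∀ i → i ∈ I → sumL (λ y → δ (σ i) y *ₖ ψ y) M ≈ ψ (σ i)
      pick-σ i m = trans (sumL-single _ M (σ i) uM (into i m) (λ y _ ne → δ*-≢ (ne ∘ ≡.sym))) (δ*-refl (σ i))

      pick-preimage : ∀ y → y ∈ M → sumL (λ i → δ (σ i) y *ₖ ψ y) I ≈ ψ y
      pick-preimage y m with onto y m
      ... | i₀ , i₀∈ , ≡.refl =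
        trans (sumL-single _ I i₀ uI i₀∈ (λ i i∈ ne → δ*-≢ (ne ∘ inj i i₀ i∈ i₀∈))) (δ*-refl (σ i₀))

  δ-× : ∀ (_≟A_ : DecidableEquality A) (_≟B_ : DecidableEquality B) {x y : A} {x′ y′ : B} →
        δ _≟A_ x y *ₖ δ _≟B_ x′ y′ ≈ δ (≡-dec _≟A_ _≟B_) (x , x′) (y , y′)
  δ-× _≟A_ _≟B_ {x} {y} {x′} {y′} = by-cases (x ≟A y) (x′ ≟B y′)
    where
    by-cases : Dec (x ≡ y) → Dec (x′ ≡ y′) → δ _≟A_ x y *ₖ δ _≟B_ x′ y′ ≈ δ (≡-dec _≟A_ _≟B_) (x , x′) (y , y′)
    by-cases (yes ≡.refl) (yes ≡.refl) =
      trans (*-cong (δ-refl _≟A_ x) (δ-refl _≟B_ x′)) (trans (*-identityˡ 1#) (sym (δ-refl (≡-dec _≟A_ _≟B_) (x , x′))))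
    by-cases (yes _) (no x′≢y′) =
      trans (*-congˡ (δ-≢ _≟B_ x′≢y′)) (trans (zeroʳ _) (sym (δ-≢ (≡-dec _≟A_ _≟B_) λ { ≡.refl → x′≢y′ ≡.refl })))
    by-cases (no x≢y) _ =
      trans (*-congʳ (δ-≢ _≟A_ x≢y)) (trans (zeroˡ _) (sym (δ-≢ (≡-dec _≟A_ _≟B_) λ { ≡.refl → x≢y ≡.refl })))

  pairs : (xs : List A) → (A → List B) → List (A × B)
  pairs xs f = concatMap (λ x → map (x ,_) (f x)) xs

  pairs-∈⁻ : ∀ xs (f : A → List B) {p} → p ∈ pairs xs f → proj₁ p ∈ xs × proj₂ p ∈ f (proj₁ p)
  pairs-∈⁻ (x ∷ xs) f m with ∈-++⁻ (map (x ,_) (f x)) m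
  ... | inj₁ m′ with ∈-map⁻ (x ,_) m′
  ...   | y , y∈ , ≡.refl = here ≡.refl , y∈
  pairs-∈⁻ (x ∷ xs) f m | inj₂ m′ = Data.Product.map₁ there (pairs-∈⁻ xs f m′)

  pairs-∈⁺ : ∀ xs (f : A → List B) {x y} → x ∈ xs → y ∈ f x → (x , y) ∈ pairs xs f
  pairs-∈⁺ (x ∷ xs) f (here ≡.refl) y∈ = ∈-++⁺ˡ (∈-map⁺ (x ,_) y∈)
  pairs-∈⁺ (x ∷ xs) f (there x∈)    y∈ = ∈-++⁺ʳ (map (x ,_) (f x)) (pairs-∈⁺ xs f x∈ y∈)

  pairs-unique : ∀ xs (f : A → List B) → Unique xs → (∀ x → Unique (f x)) → Unique (pairs xs f)
  pairs-unique []       f u        uf = []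
  pairs-unique (x ∷ xs) f (x∉ ∷ u) uf =
    Unique.++⁺ (Unique.map⁺ (λ { ≡.refl → ≡.refl }) (uf x)) (pairs-unique xs f u uf) disjoint
    where
    disjoint : ∀ {v} → v ∈ map (x ,_) (f x) × v ∈ pairs xs f → ⊥
    disjoint (m₁ , m₂) with ∈-map⁻ (x ,_) m₁
    ... | _ , _ , ≡.refl = All.lookup x∉ (proj₁ (pairs-∈⁻ xs f m₂)) ≡.refl

  sumL-pairs : ∀ (φ : A × B → Carrier) xs (f : A → List B) →
               sumL φ (pairs xs f) ≈ sumL (λ x → sumL (λ y → φ (x , y)) (f x)) xs
  sumL-pairs φ xs f = trans (sumL-concatMap φ _ xs) (sumL-cong xs (λ x → reflexive (sumL-map φ (x ,_) (f x))))

module LRB (D : LRBData) (ax : Axioms D) where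
  open LRBData D
  open Ops D
  open TDefs D
  open Axioms ax
  open ≡ using (refl; sym; trans; cong; cong₂; subst; subst₂)
  open ≡.≡-Reasoning

  ≼-refl : ∀ {n} (x : S n) → x ≼ x
  ≼-refl = ·-idem

  ≼-trans : ∀ {n} {x y z : S n} → x ≼ y → y ≼ z → x ≼ z
  ≼-trans {x = x} {y} {z} x≼y y≼z = begin
    x · z       ≡⟨ cong (x ·_) (sym y≼z) ⟩
    x · (y · z) ≡⟨ sym (·-assoc x y z) ⟩
    x · y · z   ≡⟨ cong (_· z) x≼y ⟩
    y · z       ≡⟨ y≼z ⟩
    z           ∎

  ≼-absorbʳ : ∀ {n} {x y : S n} → x ≼ y → y · x ≡ y
  ≼-absorbʳ {x = x} {y} x≼y = trans (cong (_· x) (sym x≼y)) (trans (·-lrb x y) x≼y)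

  ≼-antisym : ∀ {n} {x y : S n} → x ≼ y → y ≼ x → x ≡ y
  ≼-antisym x≼y y≼x = trans (sym y≼x) (≼-absorbʳ x≼y)

  ∅≼ : ∀ {n} (x : S n) → ∅ n ≼ x
  ∅≼ = ∅-idˡ

  ≼∅ : ∀ {n} {x : S n} → x ≼ ∅ n → x ≡ ∅ n
  ≼∅ {x = x} x≼∅ = trans (sym (∅-idʳ x)) x≼∅

  ≼-· : ∀ {n} (x y : S n) → x ≼ (x · y)
  ≼-· x y = trans (sym (·-assoc x x y)) (cong (_· y) (·-idem x))

  ·-monoʳ-≼ : ∀ {n} (g : S n) {x y : S n} → x ≼ y → (g · x) ≼ (g · y)
  ·-monoʳ-≼ g {x} {y} x≼y = begin
    g · x · (g · y) ≡⟨ sym (·-assoc (g · x) g y) ⟩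
    g · x · g · y   ≡⟨ cong (_· y) (·-lrb g x) ⟩
    g · x · y       ≡⟨ ·-assoc g x y ⟩
    g · (x · y)     ≡⟨ cong (g ·_) x≼y ⟩
    g · y           ∎

  G·≡-from-K·≡ : ∀ {n} {G K Z J : S n} → K ≼ Z → (G · K) ≼ J → K · (G · Z) ≡ K · J → G · Z ≡ J
  G·≡-from-K·≡ {G = G} {K} {Z} {J} K≼Z GK≼J K·GZ≡K·J = begin
    G · Z                   ≡⟨ cong (G ·_) (sym K≼Z) ⟩
    G · (K · Z)             ≡⟨ sym (·-assoc G K Z) ⟩
    G · K · Z               ≡⟨ cong (_· Z) (sym (·-lrb G K)) ⟩
    G · K · G · Z           ≡⟨ ·-assoc (G · K) G Z ⟩
    G · K · (G · Z)         ≡⟨ ·-assoc G K (G · Z) ⟩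
    G · (K · (G · Z))       ≡⟨ cong (G ·_) K·GZ≡K·J ⟩
    G · (K · J)             ≡⟨ sym (·-assoc G K J) ⟩
    G · K · J               ≡⟨ GK≼J ⟩
    J                       ∎

  _≺?_ : ∀ {n} (x y : S n) → Dec (x ≺ y)
  x ≺? y = (x ≼? y) ×-dec ¬? (x ≟ y)

  module _ {a p q} {A : Set a} {P : Pred A p} {Q : Pred A q} (P? : Decidable P) (Q? : Decidable Q)
           (P⊆Q : ∀ x → P x → Q x) where

    length-filter-mono : ∀ xs → length (filter P? xs) ≤ length (filter Q? xs)
    length-filter-mono [] = z≤n
    length-filter-mono (x ∷ xs) with P? x | Q? x
    ... | yes _  | yes _  = s≤s (length-filter-mono xs)
    ... | yes px | no ¬qx = ⊥-elim (¬qx (P⊆Q x px))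
    ... | no _   | yes _  = ℕ.m≤n⇒m≤1+n (length-filter-mono xs)
    ... | no _   | no _   = length-filter-mono xs

    length-filter-strictMono : ∀ {w} xs → w ∈ xs → Q w → ¬ P w →
                               length (filter P? xs) < length (filter Q? xs)
    length-filter-strictMono (x ∷ xs) (here refl) qw ¬pw with P? x | Q? x
    ... | yes px | _      = ⊥-elim (¬pw px)
    ... | no _   | yes _  = s≤s (length-filter-mono xs)
    ... | no _   | no ¬qx = ⊥-elim (¬qx qw)
    length-filter-strictMono (x ∷ xs) (there w∈) qw ¬pw with P? x | Q? x
    ... | yes _  | yes _  = s≤s (length-filter-strictMono xs w∈ qw ¬pw)
    ... | yes px | no ¬qx = ⊥-elim (¬qx (P⊆Q x px))
    ... | no _   | yes _  = ℕ.m≤n⇒m≤1+n (length-filter-strictMono xs w∈ qw ¬pw)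
    ... | no _   | no _   = length-filter-strictMono xs w∈ qw ¬pw

  interval : ∀ {n} → S n → S n → List (S n)
  interval {n} x y = filter (λ z → (x ≼? z) ×-dec (z ≼? y)) (elems n)

  private
    interval-nonempty : ∀ {n} (x y : S n) → x ≼ y → 0 < length (interval x y)
    interval-nonempty x y x≼y with interval x y
                                 | ∈-filter⁺ (λ z → (x ≼? z) ×-dec (z ≼? y)) (elems-complete y) (x≼y , ≼-refl y)
    ... | _ ∷ _ | _ = s≤s z≤n

    -- Induction on the size of the interval [x, y]: either x ⋖ y, or a z
    -- strictly between splits it into two strictly smaller intervals.
    ≺⇒rank<-bounded : ∀ k {n} (x y : S n) → length (interval x y) ≤ k → x ≺ y → rank x < rank y
    ≺⇒rank<-bounded zero x y size (x≼y , _) =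
      ⊥-elim (ℕ.<-irrefl refl (ℕ.<-≤-trans (interval-nonempty x y x≼y) size))
    ≺⇒rank<-bounded (suc k) {n} x y size x≺y with any? (λ z → (x ≺? z) ×-dec (z ≺? y)) (elems n)
    ... | no none = ℕ.≤-reflexive (sym (rank-cover x y (x≺y , between)))
      where
      between : ∀ z → x ≺ z → z ≺ y → ⊥
      between z x≺z z≺y = none (Any.map (λ { refl → x≺z , z≺y }) (elems-complete z))
    ... | yes some with Any.satisfied some
    ...   | z , ((x≼z , x≢z) , (z≼y , z≢y)) =
      ℕ.<-trans (≺⇒rank<-bounded k x z (shrink left) (x≼z , x≢z))
                (≺⇒rank<-bounded k z y (shrink right) (z≼y , z≢y))
      where
      left : length (interval x z) < length (interval x y)
      left = length-filter-strictMono _ _ (λ t (p , q) → p , ≼-trans q z≼y) (elems n) (elems-complete y)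
               (proj₁ x≺y , ≼-refl y) (λ (_ , y≼z) → z≢y (≼-antisym z≼y y≼z))
      right : length (interval z y) < length (interval x y)
      right = length-filter-strictMono _ _ (λ t (p , q) → ≼-trans x≼z p , q) (elems n) (elems-complete x)
                (≼-refl x , proj₁ x≺y) (λ (z≼x , _) → x≢z (≼-antisym x≼z z≼x))
      shrink : ∀ {m} → m < length (interval x y) → m ≤ k
      shrink lt = ℕ.≤-pred (ℕ.≤-trans lt size)

  ≺⇒rank< : ∀ {n} {x y : S n} → x ≺ y → rank x < rank y
  ≺⇒rank< {x = x} {y} = ≺⇒rank<-bounded _ x y ℕ.≤-refl

  ≼-rank1 : ∀ {n} {u z : S n} → rank u ≡ 1 → z ≼ u → z ≡ ∅ n ⊎ z ≡ u
  ≼-rank1 {n} {u} {z} ru z≼u with z ≟ u | z ≟ ∅ n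
  ... | yes z≡u | _       = inj₂ z≡u
  ... | no _    | yes z≡∅ = inj₁ z≡∅
  ... | no z≢u  | no z≢∅  = ⊥-elim (ℕ.<-irrefl refl (ℕ.<-≤-trans above-∅ (ℕ.≤-pred below-u)))
    where
    above-∅ : 0 < rank z
    above-∅ = subst (_< rank z) (rank-∅ n) (≺⇒rank< (∅≼ z , z≢∅ ∘ sym))
    below-u : rank z < 1
    below-u = subst (rank z <_) ru (≺⇒rank< (z≼u , z≢u))

  rank-Σ⁰ : ∀ (K : S 0) → rank K ≡ 0
  rank-Σ⁰ K = trans (cong rank (Σ⁰-single K)) (rank-∅ 0)

  atomsBelow : ∀ {n} → S n → List (S n)
  atomsBelow {n} F = filter (λ K → (rank K ℕ.≟ 1) ×-dec (K ≼? F)) (elems n)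

  atomsBelow⁻ : ∀ {n} {F K : S n} → K ∈ atomsBelow F → rank K ≡ 1 × K ≼ F
  atomsBelow⁻ {n} {F} K∈ = proj₂ (∈-filter⁻ (λ K → (rank K ℕ.≟ 1) ×-dec (K ≼? F)) {xs = elems n} K∈)

  atomsBelow⁺ : ∀ {n} {F K : S n} → rank K ≡ 1 → K ≼ F → K ∈ atomsBelow F
  atomsBelow⁺ {F = F} {K} rK K≼F = ∈-filter⁺ (λ K → (rank K ℕ.≟ 1) ×-dec (K ≼? F)) (elems-complete K) (rK , K≼F)

  atomsBelow-unique : ∀ {n} (F : S n) → Unique (atomsBelow F)
  atomsBelow-unique {n} F = Unique.filter⁺ _ (elems-unique n)

  ES-injective : ∀ {n} {x y : S n} → _≡_ {A = ES} (n , x) (n , y) → x ≡ y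
  ES-injective refl = refl

  mulES-diag : ∀ k (x y : S k) → mulES (k , x) (k , y) ≡ (k , x · y)
  mulES-diag k x y with k ℕ.≟ k
  ... | yes refl = refl
  ... | no k≢k   = ⊥-elim (k≢k refl)

  bES-diag : ∀ k (x y : S k) → bES (k , x) (k , y) ≡ b x y
  bES-diag k x y with k ℕ.≟ k
  ... | yes refl = refl
  ... | no k≢k   = ⊥-elim (k≢k refl)

  bot : ℕ → ES
  bot k = (k , ∅ k)

  shape-bot : ∀ ks → shape (map bot ks) ≡ ks
  shape-bot []       = refl
  shape-bot (k ∷ ks) = cong (k ∷_) (shape-bot ks)

  ≼*-bot : ∀ ys ks → ys ≼* map bot ks → ys ≡ map bot ks
  ≼*-bot []             []       []              = refl
  ≼*-bot ((k , y) ∷ ys) (_ ∷ ks) ((refl , p) ∷ ps) = cong₂ _∷_ (cong (k ,_) (≼∅ p)) (≼*-bot ys ks ps)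

  b-self : ∀ {n} (F : S n) → b F F ≡ map bot (comp F)
  b-self F with b-surj F (map bot (comp F)) (shape-bot (comp F))
  ... | G , F≼G , bFG = ≼*-bot (b F F) (comp F) (subst (b F F ≼*_) bFG (Equivalence.to (b-order F F G (≼-refl F) F≼G) F≼G))

  b-length : ∀ {n} {K F : S n} → K ≼ F → length (b K F) ≡ length (comp K)
  b-length {K = K} {F} K≼F = trans (sym (length-map proj₁ (b K F))) (cong length (b-shape K F K≼F))

  -- A chosen inverse of b_F on Σ^{f_1} × ⋯ × Σ^{f_k}; its value elsewhere is irrelevant.
  b⁻¹ : ∀ {n} (F : S n) → List ES → S n
  b⁻¹ F xs with Data.List.Properties.≡-dec ℕ._≟_ (shape xs) (comp F)
  ... | yes sh = proj₁ (b-surj F xs sh)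
  ... | no _   = F

  b⁻¹-spec : ∀ {n} (F : S n) xs → shape xs ≡ comp F → F ≼ b⁻¹ F xs × b F (b⁻¹ F xs) ≡ xs
  b⁻¹-spec F xs sh with Data.List.Properties.≡-dec ℕ._≟_ (shape xs) (comp F)
  ... | yes sh′ = proj₂ (b-surj F xs sh′)
  ... | no ¬sh  = ⊥-elim (¬sh sh)

  b⁻¹-b : ∀ {n} {K H : S n} → K ≼ H → b⁻¹ K (b K H) ≡ H
  b⁻¹-b {K = K} {H} K≼H with b⁻¹-spec K (b K H) (b-shape K H K≼H)
  ... | K≼H′ , bKH′ = b-inj K _ H K≼H′ K≼H bKH′

  toPair-η : ∀ (xs : List ES) → length xs ≡ 2 → xs ≡ proj₁ (toPair xs) ∷ proj₂ (toPair xs) ∷ []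
  toPair-η (_ ∷ _ ∷ []) refl = refl

  toPairℕ-η : ∀ (ks : List ℕ) → length ks ≡ 2 → ks ≡ proj₁ (toPairℕ ks) ∷ proj₂ (toPairℕ ks) ∷ []
  toPairℕ-η (_ ∷ _ ∷ []) refl = refl

  rank1-comp-length : ∀ {n} {K : S n} → rank K ≡ 1 → length (comp K) ≡ 2
  rank1-comp-length {K = K} rK = trans (comp-length K) (cong suc rK)

  rank1-b : ∀ {n} {K F : S n} → rank K ≡ 1 → K ≼ F → b K F ≡ proj₁ (toPair (b K F)) ∷ proj₂ (toPair (b K F)) ∷ []
  rank1-b {K = K} {F} rK K≼F = toPair-η (b K F) (trans (b-length K≼F) (rank1-comp-length rK))

  rank1-comp : ∀ {n} {K : S n} → rank K ≡ 1 → comp K ≡ proj₁ (toPairℕ (comp K)) ∷ proj₂ (toPairℕ (comp K)) ∷ []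
  rank1-comp {K = K} rK = toPairℕ-η (comp K) (rank1-comp-length rK)

  rank1-dims : ∀ {n} {K F : S n} → rank K ≡ 1 → K ≼ F →
               (proj₁ (proj₁ (toPair (b K F))) , proj₁ (proj₂ (toPair (b K F)))) ≡ toPairℕ (comp K)
  rank1-dims {K = K} {F} rK K≼F with b K F | rank1-b rK K≼F | b-shape K F K≼F
  ... | _ ∷ _ ∷ [] | _ | sh = cong toPairℕ sh

  rank1-comp-positive : ∀ {n} {K : S n} → rank K ≡ 1 → All (1 ≤_) (comp K)
  rank1-comp-positive {zero}  {K} rK with trans (sym rK) (rank-Σ⁰ K)
  ... | ()
  rank1-comp-positive {suc n} {K} rK = proj₁ (comp-isComp K)

  rank1-b-positive : ∀ {n} {K F : S n} → rank K ≡ 1 → K ≼ F →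
                     1 ≤ proj₁ (proj₁ (toPair (b K F))) × 1 ≤ proj₁ (proj₂ (toPair (b K F)))
  rank1-b-positive {K = K} {F} rK K≼F
    with subst (All (1 ≤_)) (rank1-comp rK) (rank1-comp-positive rK) | rank1-dims rK K≼F
  ... | p₁ ∷ p₂ ∷ [] | dims≡ = subst (1 ≤_) (sym (cong proj₁ dims≡)) p₁ , subst (1 ≤_) (sym (cong proj₂ dims≡)) p₂

  pair-≼*⁻ : ∀ {d₁ d₂} {a₁ u₁ : S d₁} {a₂ u₂ : S d₂} →
             ((d₁ , a₁) ∷ (d₂ , a₂) ∷ []) ≼* ((d₁ , u₁) ∷ (d₂ , u₂) ∷ []) → a₁ ≼ u₁ × a₂ ≼ u₂
  pair-≼*⁻ ((refl , p) ∷ (refl , q) ∷ []) = p , q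

  pair-≼*⁺ : ∀ {d₁ d₂} {a₁ u₁ : S d₁} {a₂ u₂ : S d₂} →
             a₁ ≼ u₁ → a₂ ≼ u₂ → ((d₁ , a₁) ∷ (d₂ , a₂) ∷ []) ≼* ((d₁ , u₁) ∷ (d₂ , u₂) ∷ [])
  pair-≼*⁺ p q = (refl , p) ∷ (refl , q) ∷ []

  pair-injective : ∀ {d₁ d₂} {a₁ u₁ : S d₁} {a₂ u₂ : S d₂} →
                   _≡_ {A = List ES} ((d₁ , a₁) ∷ (d₂ , a₂) ∷ []) ((d₁ , u₁) ∷ (d₂ , u₂) ∷ []) → a₁ ≡ u₁ × a₂ ≡ u₂
  pair-injective refl = refl , refl

  shape-pair : ∀ {d₁ d₂} (xs : List ES) → shape xs ≡ d₁ ∷ d₂ ∷ [] →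
               ∃[ z₁ ] ∃[ z₂ ] (xs ≡ (d₁ , z₁) ∷ (d₂ , z₂) ∷ [])
  shape-pair (_ ∷ _ ∷ []) refl = _ , _ , refl

  rankES : ES → ℕ
  rankES (_ , y) = rank y

  module _ {m} {K : S m} {d₁ d₂} (compK : comp K ≡ d₁ ∷ d₂ ∷ []) where

    b-self-pair : b K K ≡ bot d₁ ∷ bot d₂ ∷ []
    b-self-pair = trans (b-self K) (cong (map bot) compK)

    ⋖-from-b : ∀ {H} {u₁ : S d₁} {u₂ : S d₂} → K ≼ H → b K H ≡ (d₁ , u₁) ∷ (d₂ , u₂) ∷ [] →
               ¬ (u₁ ≡ ∅ d₁ × u₂ ≡ ∅ d₂) →
               (∀ {z₁ z₂} → z₁ ≼ u₁ → z₂ ≼ u₂ → (z₁ ≡ ∅ d₁ × z₂ ≡ ∅ d₂) ⊎ (z₁ ≡ u₁ × z₂ ≡ u₂)) → K ⋖ H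
    ⋖-from-b {H} {u₁} {u₂} K≼H bKH nonbot twoPoints = (K≼H , K≢H) , nothing-between
      where
      K≢H : K ≢ H
      K≢H refl with pair-injective (trans (sym b-self-pair) bKH)
      ... | p , q = nonbot (sym p , sym q)

      nothing-between : ∀ z → K ≺ z → z ≺ H → ⊥
      nothing-between z (K≼z , K≢z) (z≼H , z≢H) with shape-pair (b K z) (trans (b-shape K z K≼z) compK)
      ... | z₁ , z₂ , bKz
        with pair-≼*⁻ (subst₂ _≼*_ bKz bKH (Equivalence.to (b-order K z H K≼z K≼H) z≼H))
      ...   | z₁≼ , z₂≼ with twoPoints z₁≼ z₂≼
      ...     | inj₁ (refl , refl) = K≢z (sym (b-inj K z K K≼z (≼-refl K) (trans bKz (sym b-self-pair))))
      ...     | inj₂ (refl , refl) = z≢H (b-inj K z H K≼z K≼H (trans bKz (sym bKH)))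

  -- By (C3) a rank-2 H lies above exactly two atoms, and the side on which
  -- b_K H is non-trivial tells them apart.
  module _ {m} {H : S m} (rH : rank H ≡ 2) where
    private
      K₀ G₀ : S m
      K₀ = proj₁ (C3 H rH)
      G₀ = proj₁ (proj₂ (C3 H rH))

      1≢0 : 1 ≢ 0
      1≢0 ()

      first-rank1⇒G₀ : ∀ {K e t} → rank K ≡ 1 → K ≼ H → b K H ≡ e ∷ t → rankES e ≡ 1 → K ≡ G₀
      first-rank1⇒G₀ rK K≼H bKH re with C3 H rH
      ... | _ , _ , _ , _ , _ , _ , _ , atoms , (k₁ , _ , _ , _ , bK₀H) , _ with atoms _ rK K≼H
      ...   | inj₂ K≡G₀ = K≡G₀
      ...   | inj₁ refl = ⊥-elim (1≢0 (trans (sym re)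
                            (trans (cong rankES (∷-injectiveˡ (trans (sym bKH) bK₀H))) (rank-∅ k₁))))

      second-rank1⇒K₀ : ∀ {K e₀ e} → rank K ≡ 1 → K ≼ H → b K H ≡ e₀ ∷ e ∷ [] → rankES e ≡ 1 → K ≡ K₀
      second-rank1⇒K₀ rK K≼H bKH re with C3 H rH
      ... | _ , _ , _ , _ , _ , _ , _ , atoms , _ , (_ , g₂ , _ , _ , bG₀H) with atoms _ rK K≼H
      ...   | inj₁ K≡K₀ = K≡K₀
      ...   | inj₂ refl = ⊥-elim (1≢0 (trans (sym re)
                            (trans (cong rankES (∷-injectiveˡ (∷-injectiveʳ (trans (sym bKH) bG₀H)))) (rank-∅ g₂))))

    first-rank1-atom-unique : ∀ {K K′ e e′ t t′} → rank K ≡ 1 → K ≼ H → b K H ≡ e ∷ t → rankES e ≡ 1 →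
                              rank K′ ≡ 1 → K′ ≼ H → b K′ H ≡ e′ ∷ t′ → rankES e′ ≡ 1 → K ≡ K′
    first-rank1-atom-unique rK K≼H bKH re rK′ K′≼H bK′H re′ =
      trans (first-rank1⇒G₀ rK K≼H bKH re) (sym (first-rank1⇒G₀ rK′ K′≼H bK′H re′))

    second-rank1-atom-unique : ∀ {K K′ e₀ e e₀′ e′} → rank K ≡ 1 → K ≼ H → b K H ≡ e₀ ∷ e ∷ [] → rankES e ≡ 1 →
                               rank K′ ≡ 1 → K′ ≼ H → b K′ H ≡ e₀′ ∷ e′ ∷ [] → rankES e′ ≡ 1 → K ≡ K′
    second-rank1-atom-unique rK K≼H bKH re rK′ K′≼H bK′H re′ =
      trans (second-rank1⇒K₀ rK K≼H bKH re) (sym (second-rank1⇒K₀ rK′ K′≼H bK′H re′))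

  module AtomLift {N} {K x : S N} (rK : rank K ≡ 1) (K≼x : K ≼ x)
                  {d₁ d₂} {y₁ : S d₁} {y₂ : S d₂} (bKx : b K x ≡ (d₁ , y₁) ∷ (d₂ , y₂) ∷ []) where

    compK : comp K ≡ d₁ ∷ d₂ ∷ []
    compK = trans (sym (b-shape K x K≼x)) (cong shape bKx)

    liftˡ liftʳ : ES → S N
    liftˡ e = b⁻¹ K (e ∷ (d₂ , ∅ d₂) ∷ [])
    liftʳ e = b⁻¹ K ((d₁ , ∅ d₁) ∷ e ∷ [])

    record Lift (H : S N) (bKH bHx : List ES) : Set where
      field
        rank≡2 : rank H ≡ 2
        H≼x    : H ≼ x
        K≼H    : K ≼ H
        b-K-H  : b K H ≡ bKH
        b-H-x  : b H x ≡ bHx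

    private
      lift : ∀ {u₁ u₂} → u₁ ≼ y₁ → u₂ ≼ y₂ → ¬ (u₁ ≡ ∅ d₁ × u₂ ≡ ∅ d₂) →
             (∀ {z₁ z₂} → z₁ ≼ u₁ → z₂ ≼ u₂ → (z₁ ≡ ∅ d₁ × z₂ ≡ ∅ d₂) ⊎ (z₁ ≡ u₁ × z₂ ≡ u₂)) →
             Lift (b⁻¹ K ((d₁ , u₁) ∷ (d₂ , u₂) ∷ [])) ((d₁ , u₁) ∷ (d₂ , u₂) ∷ []) (b u₁ y₁ ++ b u₂ y₂)
      lift {u₁} {u₂} u₁≼ u₂≼ nonbot twoPoints = record
        { rank≡2 = trans (rank-cover K H (⋖-from-b compK K≼H bKH nonbot twoPoints)) (cong suc rK)
        ; H≼x    = H≼x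
        ; K≼H    = K≼H
        ; b-K-H  = bKH
        ; b-H-x  = bHx
        }
        where
        us : List ES
        us = (d₁ , u₁) ∷ (d₂ , u₂) ∷ []
        H : S N
        H = b⁻¹ K us
        K≼H : K ≼ H
        K≼H = proj₁ (b⁻¹-spec K us (sym compK))
        bKH : b K H ≡ us
        bKH = proj₂ (b⁻¹-spec K us (sym compK))
        H≼x : H ≼ x
        H≼x = Equivalence.from (b-order K H x K≼H K≼x) (subst₂ _≼*_ (sym bKH) (sym bKx) (pair-≼*⁺ u₁≼ u₂≼))
        bHx : b H x ≡ b u₁ y₁ ++ b u₂ y₂
        bHx = begin
          b H x                                                   ≡⟨ C2-b K H x K≼H H≼x ⟩
          concat (zipWith bES (b K H) (b K x))                    ≡⟨ cong₂ (λ p q → concat (zipWith bES p q)) bKH bKx ⟩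
          bES (d₁ , u₁) (d₁ , y₁) ++ (bES (d₂ , u₂) (d₂ , y₂) ++ [])
            ≡⟨ cong₂ (λ p q → p ++ (q ++ [])) (bES-diag d₁ u₁ y₁) (bES-diag d₂ u₂ y₂) ⟩
          b u₁ y₁ ++ (b u₂ y₂ ++ [])                              ≡⟨ cong (b u₁ y₁ ++_) (++-identityʳ (b u₂ y₂)) ⟩
          b u₁ y₁ ++ b u₂ y₂                                      ∎

      rank1≢∅ : ∀ {d} {K′ : S d} → rank K′ ≡ 1 → K′ ≢ ∅ d
      rank1≢∅ {d} rK′ refl with trans (sym rK′) (rank-∅ d)
      ... | ()

    liftˡ-spec : ∀ {K′} → rank K′ ≡ 1 → K′ ≼ y₁ →
                 Lift (liftˡ (d₁ , K′)) ((d₁ , K′) ∷ (d₂ , ∅ d₂) ∷ []) (b K′ y₁ ++ [ (d₂ , y₂) ])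
    liftˡ-spec {K′} rK′ K′≼ = subst (Lift _ _) (cong (b K′ y₁ ++_) (b-∅ d₂ y₂))
      (lift K′≼ (∅≼ y₂) (rank1≢∅ rK′ ∘ proj₁) twoPoints)
      where
      twoPoints : ∀ {z₁ z₂} → z₁ ≼ K′ → z₂ ≼ ∅ d₂ → (z₁ ≡ ∅ d₁ × z₂ ≡ ∅ d₂) ⊎ (z₁ ≡ K′ × z₂ ≡ ∅ d₂)
      twoPoints z₁≼ z₂≼ with ≼-rank1 rK′ z₁≼
      ... | inj₁ z₁≡∅ = inj₁ (z₁≡∅ , ≼∅ z₂≼)
      ... | inj₂ z₁≡K′ = inj₂ (z₁≡K′ , ≼∅ z₂≼)

    liftʳ-spec : ∀ {G′} → rank G′ ≡ 1 → G′ ≼ y₂ →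
                 Lift (liftʳ (d₂ , G′)) ((d₁ , ∅ d₁) ∷ (d₂ , G′) ∷ []) ((d₁ , y₁) ∷ b G′ y₂)
    liftʳ-spec {G′} rG′ G′≼ = subst (Lift _ _) (cong (_++ b G′ y₂) (b-∅ d₁ y₁))
      (lift (∅≼ y₁) G′≼ (rank1≢∅ rG′ ∘ proj₂) twoPoints)
      where
      twoPoints : ∀ {z₁ z₂} → z₁ ≼ ∅ d₁ → z₂ ≼ G′ → (z₁ ≡ ∅ d₁ × z₂ ≡ ∅ d₂) ⊎ (z₁ ≡ ∅ d₁ × z₂ ≡ G′)
      twoPoints z₁≼ z₂≼ with ≼-rank1 rG′ z₂≼
      ... | inj₁ z₂≡∅ = inj₁ (≼∅ z₁≼ , z₂≡∅)
      ... | inj₂ z₂≡G′ = inj₂ (≼∅ z₁≼ , z₂≡G′)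

    liftˡ-onto : ∀ {H} → H ≼ x → K ≼ H → ∀ {g₁ g₂} {G′ : S g₁} → rank G′ ≡ 1 →
                 b K H ≡ (g₁ , G′) ∷ (g₂ , ∅ g₂) ∷ [] →
                 (g₁ , G′) ∈ map (d₁ ,_) (atomsBelow y₁) × liftˡ (g₁ , G′) ≡ H
    liftˡ-onto {H} H≼x K≼H rG′ bKH
      with subst₂ _≼*_ bKH bKx (Equivalence.to (b-order K H x K≼H K≼x) H≼x)
    ... | (refl , G′≼) ∷ (refl , _) ∷ [] =
      ∈-map⁺ (d₁ ,_) (atomsBelow⁺ rG′ G′≼) , trans (cong (b⁻¹ K) (sym bKH)) (b⁻¹-b K≼H)

    liftʳ-onto : ∀ {H} → H ≼ x → K ≼ H → ∀ {k₁ k₂} {K′ : S k₂} → rank K′ ≡ 1 →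
                 b K H ≡ (k₁ , ∅ k₁) ∷ (k₂ , K′) ∷ [] →
                 (k₂ , K′) ∈ map (d₂ ,_) (atomsBelow y₂) × liftʳ (k₂ , K′) ≡ H
    liftʳ-onto {H} H≼x K≼H rK′ bKH
      with subst₂ _≼*_ bKH bKx (Equivalence.to (b-order K H x K≼H K≼x) H≼x)
    ... | (refl , _) ∷ (refl , K′≼) ∷ [] =
      ∈-map⁺ (d₂ ,_) (atomsBelow⁺ rK′ K′≼) , trans (cong (b⁻¹ K) (sym bKH)) (b⁻¹-b K≼H)

  composition-single : ∀ p → IsComposition (suc p) [ suc p ]
  composition-single p = (s≤s z≤n ∷ []) , ℕ.+-identityʳ (suc p)

  composition-pair : ∀ p q → IsComposition (suc p + suc q) (suc p ∷ suc q ∷ [])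
  composition-pair p q = (s≤s z≤n ∷ s≤s z≤n ∷ []) , cong (suc p +_) (ℕ.+-identityʳ (suc q))

  -- Via (A2) and (AP), both bracketings of x × y × z are governed by the single
  -- condition G w = j(x × y × z), G attached to the composition (dx, dy, dz).
  module TripleProduct (k l m : ℕ) (x : S (suc k)) (y : S (suc l)) (z : S (suc m)) where
    dx dy dz : ℕ
    dx = suc k
    dy = suc l
    dz = suc m

    dxyz : List ℕ
    dxyz = dx ∷ dy ∷ dz ∷ []

    InTriple : (N : ℕ) → S N → Set
    InTriple N w = att N dxyz · w ≡ j N dxyz ((dx , x) ∷ (dy , y) ∷ (dz , z) ∷ [])

    InTriple-subst : ∀ {N N′} (e : N ≡ N′) (w : S N) → InTriple N w → InTriple N′ (subst S e w)
    InTriple-subst refl w p = p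

    jxy : S (dx + dy)
    jxy = proj₂ (jPair (dx , x) (dy , y))

    jyz : S (dy + dz)
    jyz = proj₂ (jPair (dy , y) (dz , z))

    module LeftBracket (N : ℕ) (e : dx + (dy + dz) ≡ N) where
      dxy,dz : List ℕ
      dxy,dz = (dx + dy) ∷ dz ∷ []

      isComp : IsComposition N dxy,dz
      isComp = subst (λ M → IsComposition M dxy,dz) (trans (ℕ.+-assoc dx dy dz) e) (composition-pair (k + dy) m)

      jL : S (dx + dy) → S dz → S N
      jL u v = j N dxy,dz ((dx + dy , u) ∷ (dz , v) ∷ [])

      blocks : List (ℕ × List ℕ)
      blocks = (dx + dy , dx ∷ dy ∷ []) ∷ (dz , [ dz ]) ∷ []

      att≡ : att N dxyz ≡ jL (Gab dx dy) (∅ dz)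
      att≡ = trans (A2-att N blocks isComp (composition-pair k l ∷ composition-single m ∷ []))
                   (cong (jL (Gab dx dy)) (att-triv dz))

      j≡ : j N dxyz ((dx , x) ∷ (dy , y) ∷ (dz , z) ∷ []) ≡ jL jxy z
      j≡ = trans (A2-j N blocks isComp (composition-pair k l ∷ composition-single m ∷ [])
                   (((dx , x) ∷ (dy , y) ∷ []) ∷ [ (dz , z) ] ∷ []) (refl ∷ refl ∷ []))
                 (cong (jL jxy) (j-triv dz z))

      att·jL : ∀ u v → att N dxyz · jL u v ≡ jL (Gab dx dy · u) v
      att·jL u v = begin
        att N dxyz · jL u v                 ≡⟨ cong (_· jL u v) att≡ ⟩
        jL (Gab dx dy) (∅ dz) · jL u v        ≡⟨ sym (AP N dxy,dz isComp _ _ refl refl) ⟩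
        j N dxy,dz (((dx + dy , Gab dx dy) ∷ (dz , ∅ dz) ∷ []) ·* ((dx + dy , u) ∷ (dz , v) ∷ []))
          ≡⟨ cong (j N dxy,dz) (cong₂ (λ p q → p ∷ q ∷ []) (mulES-diag (dx + dy) (Gab dx dy) u)
                                                       (trans (mulES-diag dz (∅ dz) v) (cong (dz ,_) (∅-idˡ v)))) ⟩
        jL (Gab dx dy · u) v                 ∎

      att·W : ∀ w → att N dxyz · w ≡ att N dxyz · (att N dxy,dz · w)
      att·W w = trans (cong (_· w) (sym (≼-absorbʳ W≼att))) (·-assoc _ _ w)
        where
        W≼att : att N dxy,dz ≼ att N dxyz
        W≼att = subst (att N dxy,dz ≼_) (sym att≡) (j-above N dxy,dz isComp _ refl)

      jL-injective : ∀ {u u′ v v′} → jL u v ≡ jL u′ v′ → u ≡ u′ × v ≡ v′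
      jL-injective eq = pair-injective (j-inj N dxy,dz isComp _ _ refl refl eq)

      ⇒InTriple : ∀ w u → Gab dx dy · u ≡ jxy → att N dxy,dz · w ≡ jL u z → InTriple N w
      ⇒InTriple w u Gu≡ Ww≡ = begin
        att N dxyz · w                      ≡⟨ att·W w ⟩
        att N dxyz · (att N dxy,dz · w)       ≡⟨ cong (att N dxyz ·_) Ww≡ ⟩
        att N dxyz · jL u z                 ≡⟨ att·jL u z ⟩
        jL (Gab dx dy · u) z                 ≡⟨ cong (λ t → jL t z) Gu≡ ⟩
        jL jxy z                           ≡⟨ sym j≡ ⟩
        j N dxyz ((dx , x) ∷ (dy , y) ∷ (dz , z) ∷ []) ∎

      InTriple⇒ : ∀ w → InTriple N w → ∃[ u ] (Gab dx dy · u ≡ jxy × att N dxy,dz · w ≡ jL u z)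
      InTriple⇒ w inT with j-surj N dxy,dz isComp (att N dxy,dz · w) (≼-· _ w)
      ... | (_ , u) ∷ (_ , v) ∷ [] , refl , jL≡ with jL-injective (begin
            jL (Gab dx dy · u) v                 ≡⟨ sym (att·jL u v) ⟩
            att N dxyz · jL u v                 ≡⟨ cong (att N dxyz ·_) jL≡ ⟩
            att N dxyz · (att N dxy,dz · w)       ≡⟨ sym (att·W w) ⟩
            att N dxyz · w                      ≡⟨ inT ⟩
            j N dxyz ((dx , x) ∷ (dy , y) ∷ (dz , z) ∷ []) ≡⟨ j≡ ⟩
            jL jxy z                           ∎)
      ...   | Gu≡ , refl = u , Gu≡ , sym jL≡

      middle-unique : ∀ w {u u′} → att N dxy,dz · w ≡ jL u z → att N dxy,dz · w ≡ jL u′ z → u ≡ u′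
      middle-unique w p q = proj₁ (jL-injective (trans (sym p) q))

    module RightBracket (N : ℕ) (e : dx + (dy + dz) ≡ N) where
      dx,dyz : List ℕ
      dx,dyz = dx ∷ (dy + dz) ∷ []

      isComp : IsComposition N dx,dyz
      isComp = subst (λ M → IsComposition M dx,dyz) e (composition-pair k (l + dz))

      jR : S dx → S (dy + dz) → S N
      jR u v = j N dx,dyz ((dx , u) ∷ (dy + dz , v) ∷ [])

      blocks : List (ℕ × List ℕ)
      blocks = (dx , [ dx ]) ∷ (dy + dz , dy ∷ dz ∷ []) ∷ []

      att≡ : att N dxyz ≡ jR (∅ dx) (Gab dy dz)
      att≡ = trans (A2-att N blocks isComp (composition-single k ∷ composition-pair l m ∷ []))
                   (cong (λ t → jR t (Gab dy dz)) (att-triv dx))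

      j≡ : j N dxyz ((dx , x) ∷ (dy , y) ∷ (dz , z) ∷ []) ≡ jR x jyz
      j≡ = trans (A2-j N blocks isComp (composition-single k ∷ composition-pair l m ∷ [])
                   ([ (dx , x) ] ∷ ((dy , y) ∷ (dz , z) ∷ []) ∷ []) (refl ∷ refl ∷ []))
                 (cong (λ t → jR t jyz) (j-triv dx x))

      att·jR : ∀ u v → att N dxyz · jR u v ≡ jR u (Gab dy dz · v)
      att·jR u v = begin
        att N dxyz · jR u v                 ≡⟨ cong (_· jR u v) att≡ ⟩
        jR (∅ dx) (Gab dy dz) · jR u v        ≡⟨ sym (AP N dx,dyz isComp _ _ refl refl) ⟩
        j N dx,dyz (((dx , ∅ dx) ∷ (dy + dz , Gab dy dz) ∷ []) ·* ((dx , u) ∷ (dy + dz , v) ∷ []))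
          ≡⟨ cong (j N dx,dyz) (cong₂ (λ p q → p ∷ q ∷ []) (trans (mulES-diag dx (∅ dx) u) (cong (dx ,_) (∅-idˡ u)))
                                                       (mulES-diag (dy + dz) (Gab dy dz) v)) ⟩
        jR u (Gab dy dz · v)                 ∎

      att·W : ∀ w → att N dxyz · w ≡ att N dxyz · (att N dx,dyz · w)
      att·W w = trans (cong (_· w) (sym (≼-absorbʳ W≼att))) (·-assoc _ _ w)
        where
        W≼att : att N dx,dyz ≼ att N dxyz
        W≼att = subst (att N dx,dyz ≼_) (sym att≡) (j-above N dx,dyz isComp _ refl)

      jR-injective : ∀ {u u′ v v′} → jR u v ≡ jR u′ v′ → u ≡ u′ × v ≡ v′
      jR-injective eq = pair-injective (j-inj N dx,dyz isComp _ _ refl refl eq)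

      ⇒InTriple : ∀ w v → Gab dy dz · v ≡ jyz → att N dx,dyz · w ≡ jR x v → InTriple N w
      ⇒InTriple w v Gv≡ Ww≡ = begin
        att N dxyz · w                      ≡⟨ att·W w ⟩
        att N dxyz · (att N dx,dyz · w)       ≡⟨ cong (att N dxyz ·_) Ww≡ ⟩
        att N dxyz · jR x v                 ≡⟨ att·jR x v ⟩
        jR x (Gab dy dz · v)                 ≡⟨ cong (jR x) Gv≡ ⟩
        jR x jyz                           ≡⟨ sym j≡ ⟩
        j N dxyz ((dx , x) ∷ (dy , y) ∷ (dz , z) ∷ []) ∎

      InTriple⇒ : ∀ w → InTriple N w → ∃[ v ] (Gab dy dz · v ≡ jyz × att N dx,dyz · w ≡ jR x v)
      InTriple⇒ w inT with j-surj N dx,dyz isComp (att N dx,dyz · w) (≼-· _ w)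
      ... | (_ , u) ∷ (_ , v) ∷ [] , refl , jR≡ with jR-injective (begin
            jR u (Gab dy dz · v)                 ≡⟨ sym (att·jR u v) ⟩
            att N dxyz · jR u v                 ≡⟨ cong (att N dxyz ·_) jR≡ ⟩
            att N dxyz · (att N dx,dyz · w)       ≡⟨ sym (att·W w) ⟩
            att N dxyz · w                      ≡⟨ inT ⟩
            j N dxyz ((dx , x) ∷ (dy , y) ∷ (dz , z) ∷ []) ≡⟨ j≡ ⟩
            jR x jyz                           ∎)
      ...   | refl , Gv≡ = v , Gv≡ , sym jR≡

      middle-unique : ∀ w {v v′} → att N dx,dyz · w ≡ jR x v → att N dx,dyz · w ≡ jR x v′ → v ≡ v′
      middle-unique w p q = proj₂ (jR-injective (trans (sym p) q))

  _·²_ : ES × ES → ES × ES → ES × ES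
  (p₁ , p₂) ·² (q₁ , q₂) = (mulES p₁ q₁ , mulES p₂ q₂)

  private
    toPair-·* : ∀ xs ys → length xs ≡ 2 → length ys ≡ 2 → toPair (xs ·* ys) ≡ toPair xs ·² toPair ys
    toPair-·* (_ ∷ _ ∷ []) (_ ∷ _ ∷ []) refl refl = refl

    ∅₀·∅₀ : mulES (0 , ∅ 0) (0 , ∅ 0) ≡ (0 , ∅ 0)
    ∅₀·∅₀ = trans (mulES-diag 0 (∅ 0) (∅ 0)) (cong (0 ,_) (·-idem (∅ 0)))

  hat-· : ∀ {k} (f : T k) X Y → hat f (X · Y) ≡ hat f X ·² hat f Y
  hat-· (tK K rK) X Y = begin
    toPair (b K (K · (X · Y)))                ≡⟨ cong (λ t → toPair (b K t)) K·XY≡ ⟩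
    toPair (b K (K · X · (K · Y)))            ≡⟨ cong toPair (CP K (K · X) (K · Y) (≼-· K X) (≼-· K Y)) ⟩
    toPair (b K (K · X) ·* b K (K · Y))       ≡⟨ toPair-·* _ _ (trans (b-length (≼-· K X)) (rank1-comp-length rK))
                                                               (trans (b-length (≼-· K Y)) (rank1-comp-length rK)) ⟩
    toPair (b K (K · X)) ·² toPair (b K (K · Y)) ∎
    where
    K·XY≡ : K · (X · Y) ≡ K · X · (K · Y)
    K·XY≡ = sym (trans (sym (·-assoc (K · X) K Y)) (trans (cong (_· Y) (·-lrb K X)) (·-assoc K X Y)))
  hat-· {k} tb     X Y = cong₂ _,_ (sym ∅₀·∅₀) (sym (mulES-diag k X Y))
  hat-· {k} (tB _) X Y = cong₂ _,_ (sym (mulES-diag k X Y)) (sym ∅₀·∅₀)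

  hat-K· : ∀ {k} (f : T k) X → hat f (K_ f · X) ≡ hat f X
  hat-K· (tK K _) X = cong (λ t → toPair (b K t)) (trans (sym (·-assoc K K X)) (cong (_· X) (·-idem K)))
  hat-K· tb       X = cong (λ t → ((0 , ∅ 0) , (_ , t))) (∅-idˡ X)
  hat-K· (tB _)   X = cong (λ t → ((_ , t) , (0 , ∅ 0))) (∅-idˡ X)

  hat-injective : ∀ {k} (f : T k) {X Y} → K_ f ≼ X → K_ f ≼ Y → hat f X ≡ hat f Y → X ≡ Y
  hat-injective (tK K rK) {X} {Y} K≼X K≼Y eq =
    b-inj K X Y K≼X K≼Y (trans (rank1-b rK K≼X) (trans (cong (λ t → proj₁ t ∷ proj₂ t ∷ []) pair≡) (sym (rank1-b rK K≼Y))))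
    where
    pair≡ : toPair (b K X) ≡ toPair (b K Y)
    pair≡ = trans (cong (λ t → toPair (b K t)) (sym K≼X)) (trans eq (cong (λ t → toPair (b K t)) K≼Y))
  hat-injective tb     _ _ eq = ES-injective (cong proj₂ eq)
  hat-injective (tB _) _ _ eq = ES-injective (cong proj₁ eq)

  hat-dims : ∀ {k} (f : T k) {X} → K_ f ≼ X → (proj₁ (proj₁ (hat f X)) , proj₁ (proj₂ (hat f X))) ≡ dims f
  hat-dims (tK K rK) {X} K≼X =
    trans (cong (λ t → (proj₁ (proj₁ (toPair (b K t))) , proj₁ (proj₂ (toPair (b K t))))) K≼X) (rank1-dims rK K≼X)
  hat-dims tb     _ = refl
  hat-dims (tB _) _ = refl

  hat-∅ : ∀ {k} (f : T k) → hat f (∅ k) ≡ (bot (proj₁ (dims f)) , bot (proj₂ (dims f)))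
  hat-∅ {k} (tK K rK) = begin
    toPair (b K (K · ∅ k))     ≡⟨ cong (λ t → toPair (b K t)) (∅-idʳ K) ⟩
    toPair (b K K)             ≡⟨ cong toPair (b-self K) ⟩
    toPair (map bot (comp K))  ≡⟨ cong (λ t → toPair (map bot t)) (rank1-comp rK) ⟩
    (bot (proj₁ (toPairℕ (comp K))) , bot (proj₂ (toPairℕ (comp K)))) ∎
  hat-∅ tb     = refl
  hat-∅ (tB _) = refl

  hat-surjective : ∀ {k} (f : T k) Q₁ Q₂ → (proj₁ Q₁ , proj₁ Q₂) ≡ dims f → ∃[ Z ] (K_ f ≼ Z × hat f Z ≡ (Q₁ , Q₂))
  hat-surjective (tK K rK) Q₁ Q₂ dims≡ with b⁻¹-spec K (Q₁ ∷ Q₂ ∷ []) shape≡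
    where
    shape≡ : shape (Q₁ ∷ Q₂ ∷ []) ≡ comp K
    shape≡ = trans (cong (λ t → proj₁ t ∷ proj₂ t ∷ []) dims≡) (sym (rank1-comp rK))
  ... | K≼Z , bKZ = _ , K≼Z , trans (cong (λ t → toPair (b K t)) K≼Z) (cong toPair bKZ)
  hat-surjective {k} tb     (_ , z₁) (_ , z₂) refl = z₂ , ∅≼ z₂ , cong (λ t → ((0 , t) , (k , z₂))) (sym (Σ⁰-single z₁))
  hat-surjective {k} (tB _) (_ , z₁) (_ , z₂) refl = z₁ , ∅≼ z₁ , cong (λ t → ((k , z₁) , (0 , t))) (sym (Σ⁰-single z₂))

  jPair-bot : ∀ p q → jPair (bot p) (bot q) ≡ (p + q , Gab p q)
  jPair-bot zero    zero    = cong (0 ,_) (trans (j-triv 0 (∅ 0)) (sym (att-triv 0)))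
  jPair-bot zero    (suc q) = cong (suc q ,_) (trans (j-triv (suc q) (∅ (suc q))) (sym (att-triv (suc q))))
  jPair-bot (suc p) zero    = lemma (suc p + 0) (sym (ℕ.+-identityʳ (suc p)))
    where
    lemma : ∀ N → (e : suc p ≡ N) → _≡_ {A = ES} (N , j N [ suc p ] [ bot (suc p) ]) (N , att N [ suc p ])
    lemma N refl = cong (suc p ,_) (trans (j-triv (suc p) (∅ (suc p))) (sym (att-triv (suc p))))
  jPair-bot (suc p) (suc q) = cong (suc p + suc q ,_) (sym (trans
    (A2-att (suc p + suc q) ((suc p , [ suc p ]) ∷ (suc q , [ suc q ]) ∷ []) (composition-pair p q)
            (composition-single p ∷ composition-single q ∷ []))
    (cong₂ (λ s t → j (suc p + suc q) (suc p ∷ suc q ∷ []) ((suc p , s) ∷ (suc q , t) ∷ [])) (att-triv (suc p)) (att-triv (suc q)))))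

module Coefficients {c ℓ} (𝕂 : Char0Field c ℓ) (D : LRBData) where
  open Char0Field 𝕂 renaming (_+_ to _+ₖ_; _*_ to _*ₖ_)
  open LRBData D
  open Ops D
  open Hopf 𝕂 D
  open ListSum cring hiding (δ)
  open import Relation.Binary.Reasoning.Setoid setoid

  _≟ES²_ : DecidableEquality (ES × ES)
  _≟ES²_ = ≡-dec _≟ES_ _≟ES_

  _≟ES³_ : DecidableEquality (ES × ES × ES)
  _≟ES³_ = ≡-dec _≟ES_ _≟ES²_

  δ₁ : ES → ES → Carrier
  δ₁ = ListSum.δ cring _≟ES_

  δ₂ : ES × ES → ES × ES → Carrier
  δ₂ = ListSum.δ cring _≟ES²_

  δ₃ : ES × ES × ES → ES × ES × ES → Carrier
  δ₃ = ListSum.δ cring _≟ES³_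

  δ≈δ₁ : ∀ x y → δ x y ≈ δ₁ x y
  δ≈δ₁ x y with x ≟ES y
  ... | yes _ = refl
  ... | no _  = refl

  δ²≈δ₂ : ∀ x x′ y y′ → δ x y *ₖ δ x′ y′ ≈ δ₂ (x , x′) (y , y′)
  δ²≈δ₂ x x′ y y′ = trans (*-cong (δ≈δ₁ x y) (δ≈δ₁ x′ y′)) (δ-× _≟ES_ _≟ES_ {x} {y} {x′} {y′})

  δ³≈δ₃ : ∀ x x′ x″ y y′ y″ → δ x y *ₖ δ x′ y′ *ₖ δ x″ y″ ≈ δ₃ (x , x′ , x″) (y , y′ , y″)
  δ³≈δ₃ x x′ x″ y y′ y″ =
    trans (*-assoc _ _ _) (trans (*-cong (δ≈δ₁ x y) (δ²≈δ₂ x′ x″ y′ y″)) (δ-× _≟ES_ _≟ES²_ {x} {y} {x′ , x″} {y′ , y″}))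

  coeff₁≈ : ∀ v F → coeff₁ v F ≈ sumL (λ p → proj₁ p *ₖ δ₁ (proj₂ p) F) v
  coeff₁≈ []            F = refl
  coeff₁≈ ((a , G) ∷ v) F = +-cong (*-congˡ (δ≈δ₁ G F)) (coeff₁≈ v F)

  coeff₂≈ : ∀ v F F′ → coeff₂ v F F′ ≈ sumL (λ p → proj₁ p *ₖ δ₂ (proj₂ p) (F , F′)) v
  coeff₂≈ []                 F F′ = refl
  coeff₂≈ ((a , G , G′) ∷ v) F F′ = +-cong (trans (*-assoc _ _ _) (*-congˡ (δ²≈δ₂ G G′ F F′))) (coeff₂≈ v F F′)

  coeff₃≈ : ∀ v F F′ F″ → coeff₃ v F F′ F″ ≈ sumL (λ p → proj₁ p *ₖ δ₃ (proj₂ p) (F , F′ , F″)) v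
  coeff₃≈ []                      F F′ F″ = refl
  coeff₃≈ ((a , G , G′ , G″) ∷ v) F F′ F″ =
    +-cong (trans (*-assoc _ _ _) (trans (*-assoc _ _ _) (*-congˡ (trans (sym (*-assoc _ _ _)) (δ³≈δ₃ G G′ G″ F F′ F″)))))
           (coeff₃≈ v F F′ F″)

  ε≈ : ∀ v → ε v ≈ sumL (λ p → proj₁ p *ₖ basisε (proj₂ p)) v
  ε≈ []            = refl
  ε≈ ((a , F) ∷ v) = +-congˡ (ε≈ v)

  sumL-mul : ∀ (ψ : Carrier × ES → Carrier) v w →
             sumL ψ (mul v w) ≈
             sumL (λ p → sumL (λ q → sumL (λ H → ψ (proj₁ p *ₖ proj₁ q , H)) (basisMul (proj₂ p) (proj₂ q))) w) v
  sumL-mul ψ v w = trans (sumL-concatMap ψ _ v) (sumL-cong v (λ p → trans (sumL-concatMap ψ _ w) (sumL-cong w (λ q →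
                     reflexive (sumL-map ψ (λ H → (proj₁ p *ₖ proj₁ q , H)) (basisMul (proj₂ p) (proj₂ q)))))))

  sumL-mul₂ : ∀ (ψ : Carrier × ES × ES → Carrier) v w →
              sumL ψ (mul₂ v w) ≈
              sumL (λ p → sumL (λ q → sumL (λ H → sumL (λ H′ → ψ (proj₁ p *ₖ proj₁ q , H , H′))
                                                       (basisMul (proj₂ (proj₂ p)) (proj₂ (proj₂ q))))
                                            (basisMul (proj₁ (proj₂ p)) (proj₁ (proj₂ q)))) w) v
  sumL-mul₂ ψ v w = trans (sumL-concatMap ψ _ v) (sumL-cong v (λ p → trans (sumL-concatMap ψ _ w) (sumL-cong w (λ q →
    trans (sumL-concatMap ψ _ (basisMul (proj₁ (proj₂ p)) (proj₁ (proj₂ q))))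
          (sumL-cong (basisMul (proj₁ (proj₂ p)) (proj₁ (proj₂ q))) (λ H →
             reflexive (sumL-map ψ (λ H′ → (proj₁ p *ₖ proj₁ q , H , H′)) (basisMul (proj₂ (proj₂ p)) (proj₂ (proj₂ q))))))))))

  sumL-Δ : ∀ (ψ : Carrier × ES × ES → Carrier) v →
           sumL ψ (Δ v) ≈ sumL (λ p → sumL (λ t → ψ (proj₁ p , t)) (basisΔ (proj₂ p))) v
  sumL-Δ ψ v = trans (sumL-concatMap ψ _ v) (sumL-cong v (λ p → reflexive (sumL-map ψ (proj₁ p ,_) (basisΔ (proj₂ p)))))

  sumL-Δ⊗id : ∀ (ψ : Carrier × ES × ES × ES → Carrier) v →
              sumL ψ (Δ⊗id v) ≈
              sumL (λ p → sumL (λ t → ψ (proj₁ p , proj₁ t , proj₂ t , proj₂ (proj₂ p))) (basisΔ (proj₁ (proj₂ p)))) v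
  sumL-Δ⊗id ψ v = trans (sumL-concatMap ψ _ v) (sumL-cong v (λ p →
    reflexive (sumL-map ψ (λ t → (proj₁ p , proj₁ t , proj₂ t , proj₂ (proj₂ p))) (basisΔ (proj₁ (proj₂ p))))))

  sumL-id⊗Δ : ∀ (ψ : Carrier × ES × ES × ES → Carrier) v →
              sumL ψ (id⊗Δ v) ≈
              sumL (λ p → sumL (λ t → ψ (proj₁ p , proj₁ (proj₂ p) , proj₁ t , proj₂ t)) (basisΔ (proj₂ (proj₂ p)))) v
  sumL-id⊗Δ ψ v = trans (sumL-concatMap ψ _ v) (sumL-cong v (λ p →
    reflexive (sumL-map ψ (λ t → (proj₁ p , proj₁ (proj₂ p) , proj₁ t , proj₂ t)) (basisΔ (proj₂ (proj₂ p))))))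

  BasisMulAssoc : Set ℓ
  BasisMulAssoc = ∀ F G H X → sumL (λ Y → sumL (λ Z → δ₁ Z X) (basisMul Y H)) (basisMul F G)
                            ≈ sumL (λ Y → sumL (λ Z → δ₁ Z X) (basisMul F Y)) (basisMul G H)

  BasisMulUnitʳ : Set
  BasisMulUnitʳ = ∀ F → basisMul F one ≡ [ F ]

  BasisCounitˡ : Set ℓ
  BasisCounitˡ = ∀ F X → sumL (λ t → basisε (proj₁ t) *ₖ δ₁ (proj₂ t) X) (basisΔ F) ≈ δ₁ F X

  BasisCounitʳ : Set ℓ
  BasisCounitʳ = ∀ F X → sumL (λ t → basisε (proj₂ t) *ₖ δ₁ (proj₁ t) X) (basisΔ F) ≈ δ₁ F X

  BasisCoassoc : Set ℓ
  BasisCoassoc = ∀ F T → sumL (λ s → sumL (λ t → δ₃ (proj₁ t , proj₂ t , proj₂ s) T) (basisΔ (proj₁ s))) (basisΔ F)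
                       ≈ sumL (λ s → sumL (λ t → δ₃ (proj₁ s , proj₁ t , proj₂ t) T) (basisΔ (proj₂ s))) (basisΔ F)

  BasisΔMul : Set ℓ
  BasisΔMul = ∀ F G T → sumL (λ H → sumL (λ t → δ₂ t T) (basisΔ H)) (basisMul F G)
                      ≈ sumL (λ s → sumL (λ s′ → sumL (λ H₁ → sumL (λ H₂ → δ₂ (H₁ , H₂) T)
                                                                   (basisMul (proj₂ s) (proj₂ s′)))
                                                        (basisMul (proj₁ s) (proj₁ s′)))
                                             (basisΔ G))
                             (basisΔ F)

  BasisεMul : Set ℓ
  BasisεMul = ∀ F G → sumL basisε (basisMul F G) ≈ basisε F *ₖ basisε G

  private
    term₁ : ES → Carrier × ES → Carrier
    term₁ X p = proj₁ p *ₖ δ₁ (proj₂ p) X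

  mul-assoc : BasisMulAssoc → ∀ u v w → mul (mul u v) w ≈₁ mul u (mul v w)
  mul-assoc basis u v w X = trans left (trans
    (sumL-cong u (λ p → sumL-cong v (λ q → sumL-cong w (λ r → *-cong (*-assoc _ _ _) (basis (proj₂ p) (proj₂ q) (proj₂ r) X)))))
    (sym right))
    where
    left : coeff₁ (mul (mul u v) w) X ≈
           sumL (λ p → sumL (λ q → sumL (λ r → (proj₁ p *ₖ proj₁ q *ₖ proj₁ r) *ₖ
             sumL (λ Y → sumL (λ Z → δ₁ Z X) (basisMul Y (proj₂ r))) (basisMul (proj₂ p) (proj₂ q))) w) v) u
    left = begin
      coeff₁ (mul (mul u v) w) X     ≈⟨ coeff₁≈ (mul (mul u v) w) X ⟩
      sumL (term₁ X) (mul (mul u v) w) ≈⟨ sumL-mul (term₁ X) (mul u v) w ⟩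
      sumL Φ (mul u v)               ≈⟨ sumL-mul Φ u v ⟩
      sumL (λ p → sumL (λ q → sumL (λ Y → Φ (proj₁ p *ₖ proj₁ q , Y)) (basisMul (proj₂ p) (proj₂ q))) v) u
        ≈⟨ sumL-cong u (λ p → sumL-cong v (λ q → regroup (proj₁ p *ₖ proj₁ q) (basisMul (proj₂ p) (proj₂ q)))) ⟩
      _ ∎
      where
      Φ : Carrier × ES → Carrier
      Φ p = sumL (λ r → sumL (λ Z → term₁ X (proj₁ p *ₖ proj₁ r , Z)) (basisMul (proj₂ p) (proj₂ r))) w
      regroup : ∀ k Ys → sumL (λ Y → Φ (k , Y)) Ys ≈
                sumL (λ r → (k *ₖ proj₁ r) *ₖ sumL (λ Y → sumL (λ Z → δ₁ Z X) (basisMul Y (proj₂ r))) Ys) w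
      regroup k Ys = trans (sumL-swap (λ Y r → sumL (λ Z → term₁ X (k *ₖ proj₁ r , Z)) (basisMul Y (proj₂ r))) Ys w)
                           (sumL-cong w (λ r → sumL-*-sumL (k *ₖ proj₁ r) Ys (λ Y → basisMul Y (proj₂ r)) (λ _ Z → δ₁ Z X)))

    right : coeff₁ (mul u (mul v w)) X ≈
            sumL (λ p → sumL (λ q → sumL (λ r → (proj₁ p *ₖ (proj₁ q *ₖ proj₁ r)) *ₖ
              sumL (λ Y → sumL (λ Z → δ₁ Z X) (basisMul (proj₂ p) Y)) (basisMul (proj₂ q) (proj₂ r))) w) v) u
    right = begin
      coeff₁ (mul u (mul v w)) X     ≈⟨ coeff₁≈ (mul u (mul v w)) X ⟩
      sumL (term₁ X) (mul u (mul v w)) ≈⟨ sumL-mul (term₁ X) u (mul v w) ⟩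
      sumL (λ p → sumL (λ q → sumL (λ Z → term₁ X (proj₁ p *ₖ proj₁ q , Z)) (basisMul (proj₂ p) (proj₂ q))) (mul v w)) u
        ≈⟨ sumL-cong u (λ p → sumL-mul (λ q → sumL (λ Z → term₁ X (proj₁ p *ₖ proj₁ q , Z)) (basisMul (proj₂ p) (proj₂ q))) v w) ⟩
      sumL (λ p → sumL (λ q → sumL (λ r → sumL (λ Y → sumL (λ Z → term₁ X (proj₁ p *ₖ (proj₁ q *ₖ proj₁ r) , Z))
                                                     (basisMul (proj₂ p) Y)) (basisMul (proj₂ q) (proj₂ r))) w) v) u
        ≈⟨ sumL-cong u (λ p → sumL-cong v (λ q → sumL-cong w (λ r →
             sumL-*-sumL (proj₁ p *ₖ (proj₁ q *ₖ proj₁ r)) (basisMul (proj₂ q) (proj₂ r)) (basisMul (proj₂ p)) (λ _ Z → δ₁ Z X)))) ⟩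
      _ ∎

  mul-unitˡ : ∀ v → mul one₁ v ≈₁ v
  mul-unitˡ v X = begin
    coeff₁ (mul one₁ v) X    ≈⟨ coeff₁≈ (mul one₁ v) X ⟩
    sumL (term₁ X) (mul one₁ v) ≈⟨ sumL-mul (term₁ X) one₁ v ⟩
    sumL (λ q → (1# *ₖ proj₁ q) *ₖ δ₁ (proj₂ q) X +ₖ 0#) v +ₖ 0#
      ≈⟨ trans (+-identityʳ _) (sumL-cong v (λ q → trans (+-identityʳ _) (*-congʳ (*-identityˡ _)))) ⟩
    sumL (term₁ X) v         ≈⟨ sym (coeff₁≈ v X) ⟩
    coeff₁ v X               ∎

  mul-unitʳ : BasisMulUnitʳ → ∀ v → mul v one₁ ≈₁ v
  mul-unitʳ basis v X = begin
    coeff₁ (mul v one₁) X    ≈⟨ coeff₁≈ (mul v one₁) X ⟩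
    sumL (term₁ X) (mul v one₁) ≈⟨ sumL-mul (term₁ X) v one₁ ⟩
    sumL (λ p → sumL (λ H → (proj₁ p *ₖ 1#) *ₖ δ₁ H X) (basisMul (proj₂ p) one) +ₖ 0#) v
      ≈⟨ sumL-cong v (λ p → trans (+-identityʳ _)
           (trans (reflexive (≡.cong (sumL (λ H → (proj₁ p *ₖ 1#) *ₖ δ₁ H X)) (basis (proj₂ p))))
                  (trans (+-identityʳ _) (*-congʳ (*-identityʳ _))))) ⟩
    sumL (term₁ X) v         ≈⟨ sym (coeff₁≈ v X) ⟩
    coeff₁ v X               ∎

  Δ-coassoc : BasisCoassoc → ∀ v → Δ⊗id (Δ v) ≈₃ id⊗Δ (Δ v)
  Δ-coassoc basis v X Y Z = begin
    coeff₃ (Δ⊗id (Δ v)) X Y Z      ≈⟨ coeff₃≈ (Δ⊗id (Δ v)) X Y Z ⟩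
    sumL term₃ (Δ⊗id (Δ v))        ≈⟨ sumL-Δ⊗id term₃ (Δ v) ⟩
    sumL (λ p → sumL (λ t → term₃ (proj₁ p , proj₁ t , proj₂ t , proj₂ (proj₂ p))) (basisΔ (proj₁ (proj₂ p)))) (Δ v)
      ≈⟨ sumL-Δ (λ p → sumL (λ t → term₃ (proj₁ p , proj₁ t , proj₂ t , proj₂ (proj₂ p))) (basisΔ (proj₁ (proj₂ p)))) v ⟩
    sumL (λ a → sumL (λ s → sumL (λ t → proj₁ a *ₖ δ₃ (proj₁ t , proj₂ t , proj₂ s) T) (basisΔ (proj₁ s))) (basisΔ (proj₂ a))) v
      ≈⟨ sumL-cong v (λ a → trans (sumL-*-sumL (proj₁ a) (basisΔ (proj₂ a)) (basisΔ ∘ proj₁) (λ s t → δ₃ (proj₁ t , proj₂ t , proj₂ s) T))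
                           (trans (*-congˡ (basis (proj₂ a) T))
                           (sym (sumL-*-sumL (proj₁ a) (basisΔ (proj₂ a)) (basisΔ ∘ proj₂) (λ s t → δ₃ (proj₁ s , proj₁ t , proj₂ t) T))))) ⟩
    sumL (λ a → sumL (λ s → sumL (λ t → proj₁ a *ₖ δ₃ (proj₁ s , proj₁ t , proj₂ t) T) (basisΔ (proj₂ s))) (basisΔ (proj₂ a))) v
      ≈⟨ sym (sumL-Δ (λ p → sumL (λ t → term₃ (proj₁ p , proj₁ (proj₂ p) , proj₁ t , proj₂ t)) (basisΔ (proj₂ (proj₂ p)))) v) ⟩
    sumL (λ p → sumL (λ t → term₃ (proj₁ p , proj₁ (proj₂ p) , proj₁ t , proj₂ t)) (basisΔ (proj₂ (proj₂ p)))) (Δ v)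
      ≈⟨ sym (sumL-id⊗Δ term₃ (Δ v)) ⟩
    sumL term₃ (id⊗Δ (Δ v))        ≈⟨ sym (coeff₃≈ (id⊗Δ (Δ v)) X Y Z) ⟩
    coeff₃ (id⊗Δ (Δ v)) X Y Z      ∎
    where
    T : ES × ES × ES
    T = (X , Y , Z)
    term₃ : Carrier × ES × ES × ES → Carrier
    term₃ p = proj₁ p *ₖ δ₃ (proj₂ p) T

  ε-counitˡ : BasisCounitˡ → ∀ v → ε⊗id (Δ v) ≈₁ v
  ε-counitˡ basis v X = begin
    coeff₁ (ε⊗id (Δ v)) X      ≈⟨ coeff₁≈ (ε⊗id (Δ v)) X ⟩
    sumL (term₁ X) (ε⊗id (Δ v)) ≡⟨ sumL-map (term₁ X) (λ p → (proj₁ p *ₖ basisε (proj₁ (proj₂ p)) , proj₂ (proj₂ p))) (Δ v) ⟩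
    sumL (λ p → (proj₁ p *ₖ basisε (proj₁ (proj₂ p))) *ₖ δ₁ (proj₂ (proj₂ p)) X) (Δ v)
      ≈⟨ sumL-Δ (λ p → (proj₁ p *ₖ basisε (proj₁ (proj₂ p))) *ₖ δ₁ (proj₂ (proj₂ p)) X) v ⟩
    sumL (λ a → sumL (λ t → (proj₁ a *ₖ basisε (proj₁ t)) *ₖ δ₁ (proj₂ t) X) (basisΔ (proj₂ a))) v
      ≈⟨ sumL-cong v (λ a → trans (sumL-cong (basisΔ (proj₂ a)) (λ t → *-assoc _ _ _))
           (trans (sym (sumL-*ˡ (proj₁ a) _ (basisΔ (proj₂ a)))) (*-congˡ (basis (proj₂ a) X)))) ⟩
    sumL (term₁ X) v           ≈⟨ sym (coeff₁≈ v X) ⟩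
    coeff₁ v X                 ∎

  ε-counitʳ : BasisCounitʳ → ∀ v → id⊗ε (Δ v) ≈₁ v
  ε-counitʳ basis v X = begin
    coeff₁ (id⊗ε (Δ v)) X      ≈⟨ coeff₁≈ (id⊗ε (Δ v)) X ⟩
    sumL (term₁ X) (id⊗ε (Δ v)) ≡⟨ sumL-map (term₁ X) (λ p → (proj₁ p *ₖ basisε (proj₂ (proj₂ p)) , proj₁ (proj₂ p))) (Δ v) ⟩
    sumL (λ p → (proj₁ p *ₖ basisε (proj₂ (proj₂ p))) *ₖ δ₁ (proj₁ (proj₂ p)) X) (Δ v)
      ≈⟨ sumL-Δ (λ p → (proj₁ p *ₖ basisε (proj₂ (proj₂ p))) *ₖ δ₁ (proj₁ (proj₂ p)) X) v ⟩
    sumL (λ a → sumL (λ t → (proj₁ a *ₖ basisε (proj₂ t)) *ₖ δ₁ (proj₁ t) X) (basisΔ (proj₂ a))) v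
      ≈⟨ sumL-cong v (λ a → trans (sumL-cong (basisΔ (proj₂ a)) (λ t → *-assoc _ _ _))
           (trans (sym (sumL-*ˡ (proj₁ a) _ (basisΔ (proj₂ a)))) (*-congˡ (basis (proj₂ a) X)))) ⟩
    sumL (term₁ X) v           ≈⟨ sym (coeff₁≈ v X) ⟩
    coeff₁ v X                 ∎

  Δ-mul : BasisΔMul → ∀ v w → Δ (mul v w) ≈₂ mul₂ (Δ v) (Δ w)
  Δ-mul basis v w X Y = begin
    coeff₂ (Δ (mul v w)) X Y      ≈⟨ coeff₂≈ (Δ (mul v w)) X Y ⟩
    sumL term₂ (Δ (mul v w))      ≈⟨ sumL-Δ term₂ (mul v w) ⟩
    sumL (λ p → sumL (λ t → term₂ (proj₁ p , t)) (basisΔ (proj₂ p))) (mul v w)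
      ≈⟨ sumL-mul (λ p → sumL (λ t → term₂ (proj₁ p , t)) (basisΔ (proj₂ p))) v w ⟩
    sumL (λ p → sumL (λ q → sumL (λ H → sumL (λ t → (proj₁ p *ₖ proj₁ q) *ₖ δ₂ t T) (basisΔ H)) (basisMul (proj₂ p) (proj₂ q))) w) v
      ≈⟨ sumL-cong v (λ p → sumL-cong w (λ q →
           trans (sumL-*-sumL (proj₁ p *ₖ proj₁ q) (basisMul (proj₂ p) (proj₂ q)) basisΔ (λ _ t → δ₂ t T))
           (trans (*-congˡ (basis (proj₂ p) (proj₂ q) T)) (sym (scale₄ (proj₁ p *ₖ proj₁ q) (proj₂ p) (proj₂ q)))))) ⟩
    sumL (λ p → sumL (λ q → sumL (λ s → sumL (λ s′ → Ψ (proj₁ p *ₖ proj₁ q) s s′) (basisΔ (proj₂ q))) (basisΔ (proj₂ p))) w) v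
      ≈⟨ sumL-cong v (λ p → sumL-swap (λ q s → sumL (λ s′ → Ψ (proj₁ p *ₖ proj₁ q) s s′) (basisΔ (proj₂ q))) w (basisΔ (proj₂ p))) ⟩
    sumL (λ p → sumL (λ s → sumL (λ q → sumL (λ s′ → Ψ (proj₁ p *ₖ proj₁ q) s s′) (basisΔ (proj₂ q))) w) (basisΔ (proj₂ p))) v
      ≈⟨ sym (sumL-cong v (λ p → sumL-cong (basisΔ (proj₂ p)) (λ s →
             sumL-Δ (λ q → Ψ (proj₁ p *ₖ proj₁ q) s (proj₂ q)) w))) ⟩
    sumL (λ p → sumL (λ s → sumL (λ q → Ψ (proj₁ p *ₖ proj₁ q) s (proj₂ q)) (Δ w)) (basisΔ (proj₂ p))) v
      ≈⟨ sym (sumL-Δ (λ p → sumL (λ q → Ψ (proj₁ p *ₖ proj₁ q) (proj₂ p) (proj₂ q)) (Δ w)) v) ⟩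
    sumL (λ p → sumL (λ q → Ψ (proj₁ p *ₖ proj₁ q) (proj₂ p) (proj₂ q)) (Δ w)) (Δ v)
      ≈⟨ sym (sumL-mul₂ term₂ (Δ v) (Δ w)) ⟩
    sumL term₂ (mul₂ (Δ v) (Δ w)) ≈⟨ sym (coeff₂≈ (mul₂ (Δ v) (Δ w)) X Y) ⟩
    coeff₂ (mul₂ (Δ v) (Δ w)) X Y ∎
    where
    T : ES × ES
    T = (X , Y)
    term₂ : Carrier × ES × ES → Carrier
    term₂ p = proj₁ p *ₖ δ₂ (proj₂ p) T
    Ψ : Carrier → ES × ES → ES × ES → Carrier
    Ψ k s s′ = sumL (λ H₁ → sumL (λ H₂ → term₂ (k , H₁ , H₂)) (basisMul (proj₂ s) (proj₂ s′))) (basisMul (proj₁ s) (proj₁ s′))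
    scale₄ : ∀ k F G → sumL (λ s → sumL (Ψ k s) (basisΔ G)) (basisΔ F)
                     ≈ k *ₖ sumL (λ s → sumL (λ s′ → sumL (λ H₁ → sumL (λ H₂ → δ₂ (H₁ , H₂) T)
                                   (basisMul (proj₂ s) (proj₂ s′))) (basisMul (proj₁ s) (proj₁ s′))) (basisΔ G)) (basisΔ F)
    scale₄ k F G = trans (sumL-cong (basisΔ F) (λ s → sumL-cong (basisΔ G) (λ s′ →
                     sumL-*-sumL k (basisMul (proj₁ s) (proj₁ s′)) (λ _ → basisMul (proj₂ s) (proj₂ s′)) (λ H₁ H₂ → δ₂ (H₁ , H₂) T))))
                   (sumL-*-sumL k (basisΔ F) (λ _ → basisΔ G) _)

  Δ-one : Δ one₁ ≈₂ one₂
  Δ-one F F′ = refl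

  ε-mul : BasisεMul → ∀ v w → ε (mul v w) ≈ ε v *ₖ ε w
  ε-mul basis v w = begin
    ε (mul v w)                 ≈⟨ ε≈ (mul v w) ⟩
    sumL termε (mul v w)        ≈⟨ sumL-mul termε v w ⟩
    sumL (λ p → sumL (λ q → sumL (λ H → (proj₁ p *ₖ proj₁ q) *ₖ basisε H) (basisMul (proj₂ p) (proj₂ q))) w) v
      ≈⟨ sumL-cong v (λ p → sumL-cong w (λ q → trans (sym (sumL-*ˡ _ basisε (basisMul (proj₂ p) (proj₂ q))))
           (trans (*-congˡ (basis (proj₂ p) (proj₂ q))) (interchange _ _ _ _)))) ⟩
    sumL (λ p → sumL (λ q → termε p *ₖ termε q) w) v
      ≈⟨ sumL-cong v (λ p → sym (sumL-*ˡ (termε p) termε w)) ⟩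
    sumL (λ p → termε p *ₖ sumL termε w) v
      ≈⟨ sym (sumL-*ʳ _ termε v) ⟩
    sumL termε v *ₖ sumL termε w ≈⟨ *-cong (sym (ε≈ v)) (sym (ε≈ w)) ⟩
    ε v *ₖ ε w                  ∎
    where
    open import Algebra.Properties.CommutativeSemigroup *-commutativeSemigroup using (interchange)
    termε : Carrier × ES → Carrier
    termε p = proj₁ p *ₖ basisε (proj₂ p)

  ε-one : ε one₁ ≈ 1#
  ε-one = trans (+-identityʳ _) (*-identityˡ _)

module BasisIdentities {c ℓ} (𝕂 : Char0Field c ℓ) (D : LRBData) (ax : Axioms D) where
  open Char0Field 𝕂 renaming (_+_ to _+ₖ_; _*_ to _*ₖ_)
  open LRBData D
  open Ops D
  open TDefs D
  open Hopf 𝕂 D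
  open Axioms ax
  open ListSum cring hiding (δ)
  open Coefficients 𝕂 D
  open LRB D ax
  open import Relation.Binary.Reasoning.Setoid setoid

  basisMul-unitʳ : BasisMulUnitʳ
  basisMul-unitʳ (zero  , x) = ≡.cong (λ y → [ (0 , y) ]) (≡.sym (Σ⁰-single x))
  basisMul-unitʳ (suc _ , _) = ≡.refl

  basisε-mul : BasisεMul
  basisε-mul (zero  , _) G           = trans (+-identityʳ _) (sym (*-identityˡ _))
  basisε-mul (suc _ , _) (zero  , _) = trans (+-identityʳ _) (sym (zeroˡ _))
  basisε-mul (suc p , x) (suc q , y) =
    trans (reflexive (sumL-map basisε (suc p + suc q ,_) L)) (trans (sumL-zero _ L (λ _ _ → refl)) (sym (zeroˡ _)))
    where
    L : List (S (suc p + suc q))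
    L = filter (λ F → (Gab (suc p) (suc q) · F) ≟ proj₂ (jPair (suc p , x) (suc q , y))) (elems (suc p + suc q))

  private
    basisε-positive : ∀ (e : ES) → 1 ≤ proj₁ e → basisε e ≡ 0#
    basisε-positive (suc _ , _) _ = ≡.refl

    atomTerms : ∀ {n} → S n → List (ES × ES)
    atomTerms F = map (λ K → toPair (b K F)) (atomsBelow F)

    atomTerms-positive : ∀ {n} {F : S n} s → s ∈ atomTerms F → 1 ≤ proj₁ (proj₁ s) × 1 ≤ proj₁ (proj₂ s)
    atomTerms-positive {F = F} s s∈ with ∈-map⁻ (λ K → toPair (b K F)) s∈
    ... | K , K∈ , ≡.refl = rank1-b-positive (proj₁ (atomsBelow⁻ K∈)) (proj₂ (atomsBelow⁻ K∈))

    basisΔ-positive : ∀ e → 1 ≤ proj₁ e → basisΔ e ≡ (one , e) ∷ (e , one) ∷ atomTerms (proj₂ e)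
    basisΔ-positive (suc _ , _) _ = ≡.refl

  basis-counitˡ : BasisCounitˡ
  basis-counitˡ (zero , x) X =
    trans (+-identityʳ _) (trans (*-identityˡ _) (reflexive (≡.cong (λ y → δ₁ (0 , y) X) (≡.sym (Σ⁰-single x)))))
  basis-counitˡ (suc n , x) X = begin
    1# *ₖ δ₁ (suc n , x) X +ₖ (0# *ₖ δ₁ one X +ₖ sumL f (atomTerms x))
      ≈⟨ +-cong (*-identityˡ _) (+-cong (zeroˡ _) (sumL-zero f (atomTerms x) vanish)) ⟩
    δ₁ (suc n , x) X +ₖ (0# +ₖ 0#) ≈⟨ trans (+-congˡ (+-identityʳ _)) (+-identityʳ _) ⟩
    δ₁ (suc n , x) X ∎
    where
    f : ES × ES → Carrier
    f t = basisε (proj₁ t) *ₖ δ₁ (proj₂ t) X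
    vanish : ∀ s → s ∈ atomTerms x → f s ≈ 0#
    vanish s s∈ = trans (*-congʳ (reflexive (basisε-positive _ (proj₁ (atomTerms-positive s s∈))))) (zeroˡ _)

  basis-counitʳ : BasisCounitʳ
  basis-counitʳ (zero , x) X =
    trans (+-identityʳ _) (trans (*-identityˡ _) (reflexive (≡.cong (λ y → δ₁ (0 , y) X) (≡.sym (Σ⁰-single x)))))
  basis-counitʳ (suc n , x) X = begin
    0# *ₖ δ₁ one X +ₖ (1# *ₖ δ₁ (suc n , x) X +ₖ sumL f (atomTerms x))
      ≈⟨ +-cong (zeroˡ _) (+-cong (*-identityˡ _) (sumL-zero f (atomTerms x) vanish)) ⟩
    0# +ₖ (δ₁ (suc n , x) X +ₖ 0#) ≈⟨ trans (+-identityˡ _) (+-identityʳ _) ⟩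
    δ₁ (suc n , x) X ∎
    where
    f : ES × ES → Carrier
    f t = basisε (proj₂ t) *ₖ δ₁ (proj₁ t) X
    vanish : ∀ s → s ∈ atomTerms x → f s ≈ 0#
    vanish s s∈ = trans (*-congʳ (reflexive (basisε-positive _ (proj₂ (atomTerms-positive s s∈))))) (zeroˡ _)

  basisMul-unique : ∀ P Q → Unique (basisMul P Q)
  basisMul-unique (zero  , _) Q           = [] ∷ []
  basisMul-unique (suc _ , _) (zero  , _) = [] ∷ []
  basisMul-unique (suc _ , _) (suc _ , _) = Unique.map⁺ (λ { ≡.refl → ≡.refl }) (Unique.filter⁺ _ (elems-unique _))

  ∈-basisMul⁻ : ∀ p q x y X → X ∈ basisMul (suc p , x) (suc q , y) →
                ∃[ w ] (X ≡ (suc p + suc q , w) × Gab (suc p) (suc q) · w ≡ proj₂ (jPair (suc p , x) (suc q , y)))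
  ∈-basisMul⁻ p q x y X X∈ with ∈-map⁻ (suc p + suc q ,_) X∈
  ... | w , w∈ , X≡ = w , X≡ , proj₂ (∈-filter⁻ (λ F → (Gab (suc p) (suc q) · F) ≟ proj₂ (jPair (suc p , x) (suc q , y))) {xs = elems _} w∈)

  ∈-basisMul⁺ : ∀ p q x y w → Gab (suc p) (suc q) · w ≡ proj₂ (jPair (suc p , x) (suc q , y)) →
                (suc p + suc q , w) ∈ basisMul (suc p , x) (suc q , y)
  ∈-basisMul⁺ p q x y w eq =
    ∈-map⁺ (suc p + suc q ,_) (∈-filter⁺ (λ F → (Gab (suc p) (suc q) · F) ≟ proj₂ (jPair (suc p , x) (suc q , y))) (elems-complete w) eq)

  private
    ES-subst : ∀ {m n} (e : m ≡ n) (s : S m) → _≡_ {A = ES} (m , s) (n , ≡.subst S e s)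
    ES-subst ≡.refl s = ≡.refl

  -- Both bracketings of M_x * M_y * M_z contain M_X at most once, and exactly
  -- when X satisfies the common triple condition.
  module TripleAssoc (k l m : ℕ) (x : S (suc k)) (y : S (suc l)) (z : S (suc m)) (X : ES) where
    open TripleProduct k l m x y z

    F G H : ES
    F = (dx , x)
    G = (dy , y)
    H = (dz , z)

    Nl Nr : ℕ
    Nl = dx + dy + dz
    Nr = dx + (dy + dz)

    assoc : Nr ≡ Nl
    assoc = ≡.sym (ℕ.+-assoc dx dy dz)

    module L = LeftBracket Nl assoc
    module R = RightBracket Nr ≡.refl

    left⇒InTriple : ∀ Y → Y ∈ basisMul F G → X ∈ basisMul Y H → ∃[ w ] (X ≡ (Nl , w) × InTriple Nl w)
    left⇒InTriple Y Y∈ X∈ with ∈-basisMul⁻ k l x y Y Y∈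
    ... | u , ≡.refl , Gu≡ with ∈-basisMul⁻ (k + dy) m u z X X∈
    ...   | w , X≡ , Ww≡ = w , X≡ , L.⇒InTriple w u Gu≡ Ww≡

    right⇒InTriple : ∀ Y → Y ∈ basisMul G H → X ∈ basisMul F Y → ∃[ w ] (X ≡ (Nr , w) × InTriple Nr w)
    right⇒InTriple Y Y∈ X∈ with ∈-basisMul⁻ l m y z Y Y∈
    ... | v , ≡.refl , Gv≡ with ∈-basisMul⁻ k (l + dz) x v X X∈
    ...   | w , X≡ , Ww≡ = w , X≡ , R.⇒InTriple w v Gv≡ Ww≡

    InTriple⇒right : ∀ w → X ≡ (Nl , w) → InTriple Nl w → ∃[ Y ] (Y ∈ basisMul G H × X ∈ basisMul F Y)
    InTriple⇒right w X≡ inT with R.InTriple⇒ (≡.subst S (≡.sym assoc) w) (InTriple-subst (≡.sym assoc) w inT)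
    ... | v , Gv≡ , Ww≡ =
      (dy + dz , v) , ∈-basisMul⁺ l m y z v Gv≡ ,
      ≡.subst (_∈ basisMul F (dy + dz , v)) (≡.sym (≡.trans X≡ (ES-subst (≡.sym assoc) w))) (∈-basisMul⁺ k (l + dz) x v _ Ww≡)

    InTriple⇒left : ∀ w → X ≡ (Nr , w) → InTriple Nr w → ∃[ Y ] (Y ∈ basisMul F G × X ∈ basisMul Y H)
    InTriple⇒left w X≡ inT with L.InTriple⇒ (≡.subst S assoc w) (InTriple-subst assoc w inT)
    ... | u , Gu≡ , Ww≡ =
      (dx + dy , u) , ∈-basisMul⁺ k l x y u Gu≡ ,
      ≡.subst (_∈ basisMul (dx + dy , u) H) (≡.sym (≡.trans X≡ (ES-subst assoc w))) (∈-basisMul⁺ (k + dy) m u z _ Ww≡)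

    left-unique : ∀ Y Y′ → Y ∈ basisMul F G → X ∈ basisMul Y H → Y′ ∈ basisMul F G → X ∈ basisMul Y′ H → Y ≡ Y′
    left-unique Y Y′ Y∈ X∈ Y′∈ X∈′ with ∈-basisMul⁻ k l x y Y Y∈ | ∈-basisMul⁻ k l x y Y′ Y′∈
    ... | u , ≡.refl , _ | u′ , ≡.refl , _ with ∈-basisMul⁻ (k + dy) m u z X X∈ | ∈-basisMul⁻ (k + dy) m u′ z X X∈′
    ...   | w , X≡ , Ww≡ | w′ , X≡′ , Ww′≡ with ES-injective (≡.trans (≡.sym X≡) X≡′)
    ...     | ≡.refl = ≡.cong (dx + dy ,_) (L.middle-unique w Ww≡ Ww′≡)

    right-unique : ∀ Y Y′ → Y ∈ basisMul G H → X ∈ basisMul F Y → Y′ ∈ basisMul G H → X ∈ basisMul F Y′ → Y ≡ Y′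
    right-unique Y Y′ Y∈ X∈ Y′∈ X∈′ with ∈-basisMul⁻ l m y z Y Y∈ | ∈-basisMul⁻ l m y z Y′ Y′∈
    ... | v , ≡.refl , _ | v′ , ≡.refl , _ with ∈-basisMul⁻ k (l + dz) x v X X∈ | ∈-basisMul⁻ k (l + dz) x v′ X X∈′
    ...   | w , X≡ , Ww≡ | w′ , X≡′ , Ww′≡ with ES-injective (≡.trans (≡.sym X≡) X≡′)
    ...     | ≡.refl = ≡.cong (dy + dz ,_) (R.middle-unique w Ww≡ Ww′≡)

    coefficients-agree : sumL (λ Y → sumL (λ Z → δ₁ Z X) (basisMul Y H)) (basisMul F G)
                       ≈ sumL (λ Y → sumL (λ Z → δ₁ Z X) (basisMul F Y)) (basisMul G H)
    coefficients-agree with any? (λ Y → X ∈? basisMul Y H) (basisMul F G)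
      where open import Data.List.Membership.DecPropositional _≟ES_ using (_∈?_)
    ... | yes some with find some
    ...   | Y₀ , Y₀∈ , X∈ with left⇒InTriple Y₀ Y₀∈ X∈
    ...     | w , X≡ , inT with InTriple⇒right w X≡ inT
    ...       | Y₀′ , Y₀′∈ , X∈′ =
      trans (sumL-sumL-δ-unique _≟ES_ (basisMul F G) (λ Y → basisMul Y H) X (basisMul-unique F G) (λ Y → basisMul-unique Y H)
                                Y₀ Y₀∈ X∈ (λ Y Y∈ X∈″ → left-unique Y Y₀ Y∈ X∈″ Y₀∈ X∈))
            (sym (sumL-sumL-δ-unique _≟ES_ (basisMul G H) (basisMul F) X (basisMul-unique G H) (basisMul-unique F)
                                     Y₀′ Y₀′∈ X∈′ (λ Y Y∈ X∈″ → right-unique Y Y₀′ Y∈ X∈″ Y₀′∈ X∈′)))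
    coefficients-agree | no none =
      trans (sumL-sumL-δ-none _≟ES_ (basisMul F G) (λ Y → basisMul Y H) X (λ Y Y∈ X∈ → none (lose Y∈ X∈)))
            (sym (sumL-sumL-δ-none _≟ES_ (basisMul G H) (basisMul F) X no-right))
      where
      no-right : ∀ Y → Y ∈ basisMul G H → X ∉ basisMul F Y
      no-right Y Y∈ X∈ with right⇒InTriple Y Y∈ X∈
      ... | w , X≡ , inT with InTriple⇒left w X≡ inT
      ...   | Y′ , Y′∈ , X∈′ = none (lose Y′∈ X∈′)

  basisMul-assoc : BasisMulAssoc
  basisMul-assoc (zero , _) G H X = trans (+-identityʳ _) (sumL-cong (basisMul G H) (λ Y → sym (+-identityʳ _)))
  basisMul-assoc (suc _ , _) (zero , _) H X = trans (+-identityʳ _) (sym (+-identityʳ _))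
  basisMul-assoc F@(suc _ , _) G@(suc _ , _) (zero , z) X =
    trans (sumL-cong (basisMul F G) (λ Y → trans (reflexive (≡.cong (sumL (λ Z → δ₁ Z X)) (unitʳ Y))) (+-identityʳ (δ₁ Y X))))
          (sym (+-identityʳ _))
    where
    unitʳ : ∀ Y → basisMul Y (0 , z) ≡ [ Y ]
    unitʳ Y = ≡.trans (≡.cong (basisMul Y) (≡.cong (0 ,_) (Σ⁰-single z))) (basisMul-unitʳ Y)
  basisMul-assoc (suc k , x) (suc l , y) (suc m , z) X = TripleAssoc.coefficients-agree k l m x y z X

  private
    toTriple : List ES → ES × ES × ES
    toTriple (p ∷ q ∷ r ∷ _) = p , q , r
    toTriple _               = one , one , one

  -- The doubly-iterated atom terms of (Δ ⊗ id) Δ M_x and of (id ⊗ Δ) Δ M_x are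
  -- both in bijection with the rank-2 elements H ≤ x: an atom K ≤ x together
  -- with an atom of the first (resp. second) factor of b_K x lifts to H, and
  -- (C3) recovers K from H.
  module Coassoc (n : ℕ) (x : S (suc n)) (T : ES × ES × ES) where
    N : ℕ
    N = suc n

    F₁ F₂ : S N → ES
    F₁ K = proj₁ (toPair (b K x))
    F₂ K = proj₂ (toPair (b K x))

    atomPairs : (S N → ES) → List (S N × ES)
    atomPairs f = pairs (atomsBelow x) (λ K → map (proj₁ (f K) ,_) (atomsBelow (proj₂ (f K))))

    Iˡ Iʳ : List (S N × ES)
    Iˡ = atomPairs F₁
    Iʳ = atomPairs F₂

    σˡ σʳ : S N × ES → S N
    σˡ (K , e) = b⁻¹ K (e ∷ bot (proj₁ (F₂ K)) ∷ [])
    σʳ (K , e) = b⁻¹ K (bot (proj₁ (F₁ K)) ∷ e ∷ [])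

    Rank2Below : S N → Set
    Rank2Below H = rank H ≡ 2 × H ≼ x

    rank2Below : List (S N)
    rank2Below = filter (λ H → (rank H ℕ.≟ 2) ×-dec (H ≼? x)) (elems N)

    rank2Below⁻ : ∀ {H} → H ∈ rank2Below → Rank2Below H
    rank2Below⁻ H∈ = proj₂ (∈-filter⁻ (λ H → (rank H ℕ.≟ 2) ×-dec (H ≼? x)) {xs = elems N} H∈)

    rank2Below⁺ : ∀ {H} → Rank2Below H → H ∈ rank2Below
    rank2Below⁺ {H} = ∈-filter⁺ (λ H → (rank H ℕ.≟ 2) ×-dec (H ≼? x)) (elems-complete H)

    ψ : S N → Carrier
    ψ H = δ₃ (toTriple (b H x)) T

    record Info (σ : S N × ES → S N) (K : S N) (e : ES) (bKH : List ES) (triple : ES × ES × ES) : Set where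
      field
        rK     : rank K ≡ 1
        re     : rankES e ≡ 1
        below  : Rank2Below (σ (K , e))
        K≼H    : K ≼ σ (K , e)
        b-K-H  : b K (σ (K , e)) ≡ bKH
        b-H-x  : toTriple (b (σ (K , e)) x) ≡ triple

    module Lifts {K : S N} (K∈ : K ∈ atomsBelow x) =
      AtomLift (proj₁ (atomsBelow⁻ K∈)) (proj₂ (atomsBelow⁻ K∈)) (rank1-b (proj₁ (atomsBelow⁻ K∈)) (proj₂ (atomsBelow⁻ K∈)))

    infoˡ : ∀ {K K′} → K ∈ atomsBelow x → K′ ∈ atomsBelow (proj₂ (F₁ K)) →
            Info σˡ K (proj₁ (F₁ K) , K′) ((proj₁ (F₁ K) , K′) ∷ bot (proj₁ (F₂ K)) ∷ [])
                 (proj₁ (toPair (b K′ (proj₂ (F₁ K)))) , proj₂ (toPair (b K′ (proj₂ (F₁ K)))) , F₂ K)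
    infoˡ {K} {K′} K∈ K′∈ with atomsBelow⁻ K′∈
    ... | rK′ , K′≼ = record
      { rK = proj₁ (atomsBelow⁻ K∈) ; re = rK′ ; below = rank≡2 , H≼x ; K≼H = K≼H ; b-K-H = b-K-H
      ; b-H-x = ≡.trans (≡.cong toTriple b-H-x) (≡.cong (λ l → toTriple (l ++ [ F₂ K ])) (rank1-b rK′ K′≼)) }
      where open Lifts.Lift K∈ (Lifts.liftˡ-spec K∈ rK′ K′≼)

    infoʳ : ∀ {K K′} → K ∈ atomsBelow x → K′ ∈ atomsBelow (proj₂ (F₂ K)) →
            Info σʳ K (proj₁ (F₂ K) , K′) (bot (proj₁ (F₁ K)) ∷ (proj₁ (F₂ K) , K′) ∷ [])
                 (F₁ K , proj₁ (toPair (b K′ (proj₂ (F₂ K)))) , proj₂ (toPair (b K′ (proj₂ (F₂ K)))))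
    infoʳ {K} {K′} K∈ K′∈ with atomsBelow⁻ K′∈
    ... | rK′ , K′≼ = record
      { rK = proj₁ (atomsBelow⁻ K∈) ; re = rK′ ; below = rank≡2 , H≼x ; K≼H = K≼H ; b-K-H = b-K-H
      ; b-H-x = ≡.trans (≡.cong toTriple b-H-x) (≡.cong (λ l → toTriple (F₁ K ∷ l)) (rank1-b rK′ K′≼)) }
      where open Lifts.Lift K∈ (Lifts.liftʳ-spec K∈ rK′ K′≼)

    Iˡ⁻ : ∀ {K e} → (K , e) ∈ Iˡ →
          K ∈ atomsBelow x × ∃[ K′ ] (K′ ∈ atomsBelow (proj₂ (F₁ K)) × e ≡ (proj₁ (F₁ K) , K′))
    Iˡ⁻ {K} i∈ with pairs-∈⁻ (atomsBelow x) _ i∈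
    ... | K∈ , e∈ with ∈-map⁻ (proj₁ (F₁ K) ,_) e∈
    ...   | K′ , K′∈ , e≡ = K∈ , K′ , K′∈ , e≡

    Iʳ⁻ : ∀ {K e} → (K , e) ∈ Iʳ →
          K ∈ atomsBelow x × ∃[ K′ ] (K′ ∈ atomsBelow (proj₂ (F₂ K)) × e ≡ (proj₁ (F₂ K) , K′))
    Iʳ⁻ {K} i∈ with pairs-∈⁻ (atomsBelow x) _ i∈
    ... | K∈ , e∈ with ∈-map⁻ (proj₁ (F₂ K) ,_) e∈
    ...   | K′ , K′∈ , e≡ = K∈ , K′ , K′∈ , e≡

    σˡ-into : ∀ i → i ∈ Iˡ → σˡ i ∈ rank2Below
    σˡ-into (K , e) i∈ with Iˡ⁻ i∈
    ... | K∈ , K′ , K′∈ , ≡.refl = rank2Below⁺ (Info.below (infoˡ K∈ K′∈))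

    σʳ-into : ∀ i → i ∈ Iʳ → σʳ i ∈ rank2Below
    σʳ-into (K , e) i∈ with Iʳ⁻ i∈
    ... | K∈ , K′ , K′∈ , ≡.refl = rank2Below⁺ (Info.below (infoʳ K∈ K′∈))

    σˡ-onto : ∀ H → H ∈ rank2Below → ∃[ i ] (i ∈ Iˡ × σˡ i ≡ H)
    σˡ-onto H H∈ with rank2Below⁻ H∈
    ... | rH , H≼x with C3 H rH
    ...   | _ , G₀ , _ , rG₀ , _ , G₀≼H , _ , _ , _ , (_ , _ , G′ , rG′ , bG₀H)
      with Lifts.liftˡ-onto (atomsBelow⁺ rG₀ (≼-trans G₀≼H H≼x)) H≼x G₀≼H rG′ bG₀H
    ...     | e∈ , σ≡ = (G₀ , _) , pairs-∈⁺ (atomsBelow x) _ (atomsBelow⁺ rG₀ (≼-trans G₀≼H H≼x)) e∈ , σ≡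

    σʳ-onto : ∀ H → H ∈ rank2Below → ∃[ i ] (i ∈ Iʳ × σʳ i ≡ H)
    σʳ-onto H H∈ with rank2Below⁻ H∈
    ... | rH , H≼x with C3 H rH
    ...   | K₀ , _ , rK₀ , _ , K₀≼H , _ , _ , _ , (_ , _ , K″ , rK″ , bK₀H) , _
      with Lifts.liftʳ-onto (atomsBelow⁺ rK₀ (≼-trans K₀≼H H≼x)) H≼x K₀≼H rK″ bK₀H
    ...     | e∈ , σ≡ = (K₀ , _) , pairs-∈⁺ (atomsBelow x) _ (atomsBelow⁺ rK₀ (≼-trans K₀≼H H≼x)) e∈ , σ≡

    Info-injectiveˡ : ∀ {σ K K′ e e′ t t′ tr tr′} → Info σ K e (e ∷ t) tr → Info σ K′ e′ (e′ ∷ t′) tr′ →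
                      σ (K , e) ≡ σ (K′ , e′) → (K , e) ≡ (K′ , e′)
    Info-injectiveˡ {σ} {K} {K′} {e} {e′} {t} {t′} I I′ σ≡ = same-atom
      (first-rank1-atom-unique (proj₁ (Info.below I)) (Info.rK I) (Info.K≼H I) (Info.b-K-H I) (Info.re I)
                                                      (Info.rK I′) K′≼H bK′H (Info.re I′))
      where
      K′≼H : K′ ≼ σ (K , e)
      K′≼H = ≡.subst (K′ ≼_) (≡.sym σ≡) (Info.K≼H I′)
      bK′H : b K′ (σ (K , e)) ≡ e′ ∷ t′
      bK′H = ≡.subst (λ H → b K′ H ≡ e′ ∷ t′) (≡.sym σ≡) (Info.b-K-H I′)
      same-atom : K ≡ K′ → (K , e) ≡ (K′ , e′)
      same-atom ≡.refl = ≡.cong (K ,_) (∷-injectiveˡ (≡.trans (≡.sym (Info.b-K-H I)) bK′H))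

    Info-injectiveʳ : ∀ {σ K K′ e e′ e₀ e₀′ tr tr′} → Info σ K e (e₀ ∷ e ∷ []) tr → Info σ K′ e′ (e₀′ ∷ e′ ∷ []) tr′ →
                      σ (K , e) ≡ σ (K′ , e′) → (K , e) ≡ (K′ , e′)
    Info-injectiveʳ {σ} {K} {K′} {e} {e′} {e₀} {e₀′} I I′ σ≡ = same-atom
      (second-rank1-atom-unique (proj₁ (Info.below I)) (Info.rK I) (Info.K≼H I) (Info.b-K-H I) (Info.re I)
                                                       (Info.rK I′) K′≼H bK′H (Info.re I′))
      where
      K′≼H : K′ ≼ σ (K , e)
      K′≼H = ≡.subst (K′ ≼_) (≡.sym σ≡) (Info.K≼H I′)
      bK′H : b K′ (σ (K , e)) ≡ e₀′ ∷ e′ ∷ []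
      bK′H = ≡.subst (λ H → b K′ H ≡ e₀′ ∷ e′ ∷ []) (≡.sym σ≡) (Info.b-K-H I′)
      same-atom : K ≡ K′ → (K , e) ≡ (K′ , e′)
      same-atom ≡.refl = ≡.cong (K ,_) (∷-injectiveˡ (∷-injectiveʳ (≡.trans (≡.sym (Info.b-K-H I)) bK′H)))

    σˡ-injective : ∀ i i′ → i ∈ Iˡ → i′ ∈ Iˡ → σˡ i ≡ σˡ i′ → i ≡ i′
    σˡ-injective (K , _) (K′ , _) i∈ i′∈ with Iˡ⁻ i∈ | Iˡ⁻ i′∈
    ... | K∈ , L , L∈ , ≡.refl | K′∈ , L′ , L′∈ , ≡.refl = Info-injectiveˡ (infoˡ K∈ L∈) (infoˡ K′∈ L′∈)

    σʳ-injective : ∀ i i′ → i ∈ Iʳ → i′ ∈ Iʳ → σʳ i ≡ σʳ i′ → i ≡ i′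
    σʳ-injective (K , _) (K′ , _) i∈ i′∈ with Iʳ⁻ i∈ | Iʳ⁻ i′∈
    ... | K∈ , L , L∈ , ≡.refl | K′∈ , L′ , L′∈ , ≡.refl = Info-injectiveʳ (infoʳ K∈ L∈) (infoʳ K′∈ L′∈)

    private
      atomPairs-unique : ∀ f → Unique (atomPairs f)
      atomPairs-unique f = pairs-unique (atomsBelow x) _ (atomsBelow-unique x)
                             (λ K → Unique.map⁺ (λ { ≡.refl → ≡.refl }) (atomsBelow-unique (proj₂ (f K))))

      rank2Below-unique : Unique rank2Below
      rank2Below-unique = Unique.filter⁺ _ (elems-unique N)

    sumL-atomPairs : ∀ f (φ : S N × ES → Carrier) →
                     sumL φ (atomPairs f) ≈ sumL (λ K → sumL (λ K′ → φ (K , (proj₁ (f K) , K′))) (atomsBelow (proj₂ (f K)))) (atomsBelow x)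
    sumL-atomPairs f φ = trans (sumL-pairs φ (atomsBelow x) _)
      (sumL-cong (atomsBelow x) (λ K → reflexive (sumL-map (λ e → φ (K , e)) (proj₁ (f K) ,_) (atomsBelow (proj₂ (f K))))))

    terms-as-liftsˡ : ∀ {K} → K ∈ atomsBelow x →
                      sumL (λ t → δ₃ (proj₁ t , proj₂ t , F₂ K) T) (atomTerms (proj₂ (F₁ K)))
                      ≈ sumL (λ K′ → ψ (σˡ (K , (proj₁ (F₁ K) , K′)))) (atomsBelow (proj₂ (F₁ K)))
    terms-as-liftsˡ {K} K∈ =
      trans (reflexive (sumL-map (λ t → δ₃ (proj₁ t , proj₂ t , F₂ K) T) (λ K′ → toPair (b K′ (proj₂ (F₁ K)))) (atomsBelow (proj₂ (F₁ K)))))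
            (sumL-cong-∈ _ (λ K′ K′∈ → reflexive (≡.cong (λ t → δ₃ t T) (≡.sym (Info.b-H-x (infoˡ K∈ K′∈))))))

    terms-as-liftsʳ : ∀ {K} → K ∈ atomsBelow x →
                      sumL (λ t → δ₃ (F₁ K , proj₁ t , proj₂ t) T) (atomTerms (proj₂ (F₂ K)))
                      ≈ sumL (λ K′ → ψ (σʳ (K , (proj₁ (F₂ K) , K′)))) (atomsBelow (proj₂ (F₂ K)))
    terms-as-liftsʳ {K} K∈ =
      trans (reflexive (sumL-map (λ t → δ₃ (F₁ K , proj₁ t , proj₂ t) T) (λ K′ → toPair (b K′ (proj₂ (F₂ K)))) (atomsBelow (proj₂ (F₂ K)))))
            (sumL-cong-∈ _ (λ K′ K′∈ → reflexive (≡.cong (λ t → δ₃ t T) (≡.sym (Info.b-H-x (infoʳ K∈ K′∈))))))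

    iterated-left≈rank2 : sumL (λ s → sumL (λ t → δ₃ (proj₁ t , proj₂ t , proj₂ s) T) (atomTerms (proj₂ (proj₁ s)))) (atomTerms x)
                        ≈ sumL ψ rank2Below
    iterated-left≈rank2 = begin
      sumL (λ s → sumL (λ t → δ₃ (proj₁ t , proj₂ t , proj₂ s) T) (atomTerms (proj₂ (proj₁ s)))) (atomTerms x)
        ≡⟨ sumL-map _ (λ K → toPair (b K x)) (atomsBelow x) ⟩
      sumL (λ K → sumL (λ t → δ₃ (proj₁ t , proj₂ t , F₂ K) T) (atomTerms (proj₂ (F₁ K)))) (atomsBelow x)
        ≈⟨ sumL-cong-∈ (atomsBelow x) (λ K → terms-as-liftsˡ) ⟩
      sumL (λ K → sumL (λ K′ → ψ (σˡ (K , (proj₁ (F₁ K) , K′)))) (atomsBelow (proj₂ (F₁ K)))) (atomsBelow x)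
        ≈⟨ sumL-atomPairs F₁ (ψ ∘ σˡ) ⟨
      sumL (ψ ∘ σˡ) Iˡ
        ≈⟨ sumL-bijection _≟_ ψ σˡ (atomPairs-unique F₁) rank2Below-unique σˡ-into σˡ-onto σˡ-injective ⟩
      sumL ψ rank2Below ∎

    iterated-right≈rank2 : sumL (λ s → sumL (λ t → δ₃ (proj₁ s , proj₁ t , proj₂ t) T) (atomTerms (proj₂ (proj₂ s)))) (atomTerms x)
                         ≈ sumL ψ rank2Below
    iterated-right≈rank2 = begin
      sumL (λ s → sumL (λ t → δ₃ (proj₁ s , proj₁ t , proj₂ t) T) (atomTerms (proj₂ (proj₂ s)))) (atomTerms x)
        ≡⟨ sumL-map _ (λ K → toPair (b K x)) (atomsBelow x) ⟩
      sumL (λ K → sumL (λ t → δ₃ (F₁ K , proj₁ t , proj₂ t) T) (atomTerms (proj₂ (F₂ K)))) (atomsBelow x)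
        ≈⟨ sumL-cong-∈ (atomsBelow x) (λ K → terms-as-liftsʳ) ⟩
      sumL (λ K → sumL (λ K′ → ψ (σʳ (K , (proj₁ (F₂ K) , K′)))) (atomsBelow (proj₂ (F₂ K)))) (atomsBelow x)
        ≈⟨ sumL-atomPairs F₂ (ψ ∘ σʳ) ⟨
      sumL (ψ ∘ σʳ) Iʳ
        ≈⟨ sumL-bijection _≟_ ψ σʳ (atomPairs-unique F₂) rank2Below-unique σʳ-into σʳ-onto σʳ-injective ⟩
      sumL ψ rank2Below ∎

  private
    rearrange : ∀ A B C P Q U V → (A +ₖ 0#) +ₖ ((B +ₖ (C +ₖ P)) +ₖ (Q +ₖ (U +ₖ V)))
                                ≈ (A +ₖ (B +ₖ Q)) +ₖ ((C +ₖ 0#) +ₖ (U +ₖ (P +ₖ V)))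
    rearrange = solve 7 (λ A B C P Q U V → ((A ⊕ id) ⊕ ((B ⊕ (C ⊕ P)) ⊕ (Q ⊕ (U ⊕ V))))
                                         ⊜ ((A ⊕ (B ⊕ Q)) ⊕ ((C ⊕ id) ⊕ (U ⊕ (P ⊕ V))))) refl
      where open import Algebra.Solver.CommutativeMonoid +-commutativeMonoid using (solve; _⊜_; _⊕_; id)

  basis-coassoc : BasisCoassoc
  basis-coassoc (zero , x) T = refl
  basis-coassoc (suc n , x) T = begin
    (A +ₖ 0#) +ₖ ((B +ₖ (C +ₖ P)) +ₖ sumL f R)          ≈⟨ +-congˡ (+-congˡ expand-f) ⟩
    (A +ₖ 0#) +ₖ ((B +ₖ (C +ₖ P)) +ₖ (Q +ₖ (U +ₖ Vˡ)))  ≈⟨ +-congˡ (+-congˡ (+-congˡ (+-congˡ Vˡ≈Vʳ))) ⟩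
    (A +ₖ 0#) +ₖ ((B +ₖ (C +ₖ P)) +ₖ (Q +ₖ (U +ₖ Vʳ)))  ≈⟨ rearrange A B C P Q U Vʳ ⟩
    (A +ₖ (B +ₖ Q)) +ₖ ((C +ₖ 0#) +ₖ (U +ₖ (P +ₖ Vʳ)))  ≈⟨ sym (+-congˡ (+-congˡ expand-g)) ⟩
    (A +ₖ (B +ₖ Q)) +ₖ ((C +ₖ 0#) +ₖ sumL g R)          ∎
    where
    open Coassoc n x T using (iterated-left≈rank2; iterated-right≈rank2)
    Fe : ES
    Fe = (suc n , x)
    R : List (ES × ES)
    R = atomTerms x
    f g : ES × ES → Carrier
    f s = sumL (λ t → δ₃ (proj₁ t , proj₂ t , proj₂ s) T) (basisΔ (proj₁ s))
    g s = sumL (λ t → δ₃ (proj₁ s , proj₁ t , proj₂ t) T) (basisΔ (proj₂ s))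
    A B C P Q U Vˡ Vʳ : Carrier
    A = δ₃ (one , one , Fe) T
    B = δ₃ (one , Fe , one) T
    C = δ₃ (Fe , one , one) T
    P = sumL (λ t → δ₃ (proj₁ t , proj₂ t , one) T) R
    Q = sumL (λ s → δ₃ (one , proj₁ s , proj₂ s) T) R
    U = sumL (λ s → δ₃ (proj₁ s , one , proj₂ s) T) R
    Vˡ = sumL (λ s → sumL (λ t → δ₃ (proj₁ t , proj₂ t , proj₂ s) T) (atomTerms (proj₂ (proj₁ s)))) R
    Vʳ = sumL (λ s → sumL (λ t → δ₃ (proj₁ s , proj₁ t , proj₂ t) T) (atomTerms (proj₂ (proj₂ s)))) R
    Vˡ≈Vʳ : Vˡ ≈ Vʳ
    Vˡ≈Vʳ = trans iterated-left≈rank2 (sym iterated-right≈rank2)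
    expand-f : sumL f R ≈ Q +ₖ (U +ₖ Vˡ)
    expand-f = begin
      sumL f R ≈⟨ sumL-cong-∈ R (λ s s∈ → reflexive (≡.cong (sumL (λ t → δ₃ (proj₁ t , proj₂ t , proj₂ s) T))
                                                            (basisΔ-positive (proj₁ s) (proj₁ (atomTerms-positive s s∈))))) ⟩
      sumL (λ s → δ₃ (one , proj₁ s , proj₂ s) T +ₖ (δ₃ (proj₁ s , one , proj₂ s) T +ₖ
                  sumL (λ t → δ₃ (proj₁ t , proj₂ t , proj₂ s) T) (atomTerms (proj₂ (proj₁ s))))) R
        ≈⟨ trans (sumL-+ _ _ R) (+-congˡ (sumL-+ _ _ R)) ⟩
      Q +ₖ (U +ₖ Vˡ) ∎
    expand-g : sumL g R ≈ U +ₖ (P +ₖ Vʳ)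
    expand-g = begin
      sumL g R ≈⟨ sumL-cong-∈ R (λ s s∈ → reflexive (≡.cong (sumL (λ t → δ₃ (proj₁ s , proj₁ t , proj₂ t) T))
                                                            (basisΔ-positive (proj₂ s) (proj₂ (atomTerms-positive s s∈))))) ⟩
      sumL (λ s → δ₃ (proj₁ s , one , proj₂ s) T +ₖ (δ₃ (proj₁ s , proj₂ s , one) T +ₖ
                  sumL (λ t → δ₃ (proj₁ s , proj₁ t , proj₂ t) T) (atomTerms (proj₂ (proj₂ s))))) R
        ≈⟨ trans (sumL-+ _ _ R) (+-congˡ (sumL-+ _ _ R)) ⟩
      U +ₖ (P +ₖ Vʳ) ∎

  InProduct : ℕ → ℕ → ES → ES → ES → Set
  InProduct p q P P′ Q = proj₁ Q ≡ p + q × mulES (p + q , Gab p q) Q ≡ jPair P P′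

  private
    ∈-single⇒InProduct : ∀ g (x : S (suc g)) N → suc g ≡ N → ∀ {Q} → Q ∈ [ (suc g , x) ] →
                         proj₁ Q ≡ N × mulES (N , att N [ suc g ]) Q ≡ (N , j N [ suc g ] [ (suc g , x) ])
    ∈-single⇒InProduct g x N ≡.refl (here ≡.refl) = ≡.refl , ≡.trans (mulES-diag (suc g) _ x)
      (≡.cong (suc g ,_) (≡.trans (≡.cong (_· x) (att-triv (suc g))) (≡.trans (∅-idˡ x) (≡.sym (j-triv (suc g) x)))))

    InProduct⇒∈-single : ∀ g (x : S (suc g)) N → suc g ≡ N → ∀ {Q} → proj₁ Q ≡ N →
                         mulES (N , att N [ suc g ]) Q ≡ (N , j N [ suc g ] [ (suc g , x) ]) → Q ∈ [ (suc g , x) ]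
    InProduct⇒∈-single g x N ≡.refl {_ , w} ≡.refl eq = here (≡.cong (suc g ,_) (≡.trans (≡.sym (∅-idˡ w))
      (≡.trans (≡.cong (_· w) (≡.sym (att-triv (suc g)))) (≡.trans (ES-injective (≡.trans (≡.sym (mulES-diag (suc g) _ w)) eq)) (j-triv (suc g) x)))))

  ∈-basisMul⇒InProduct : ∀ {p q} P P′ {Q} → proj₁ P ≡ p → proj₁ P′ ≡ q → Q ∈ basisMul P P′ → InProduct p q P P′ Q
  ∈-basisMul⇒InProduct (zero , _) (p′ , x′) ≡.refl ≡.refl (here ≡.refl) = ≡.refl , ≡.trans (mulES-diag p′ _ x′)
    (≡.cong (p′ ,_) (≡.trans (≡.cong (_· x′) (att-triv p′)) (≡.trans (∅-idˡ x′) (≡.sym (j-triv p′ x′)))))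
  ∈-basisMul⇒InProduct (suc g , x) (zero , _) ≡.refl ≡.refl Q∈ = ∈-single⇒InProduct g x (suc g + 0) (≡.sym (ℕ.+-identityʳ (suc g))) Q∈
  ∈-basisMul⇒InProduct (suc g , x) (suc g′ , x′) ≡.refl ≡.refl Q∈ with ∈-basisMul⁻ g g′ x x′ _ Q∈
  ... | w , ≡.refl , Gw≡ = ≡.refl , ≡.trans (mulES-diag _ _ w) (≡.cong (suc g + suc g′ ,_) Gw≡)

  InProduct⇒∈-basisMul : ∀ {p q} P P′ {Q} → proj₁ P ≡ p → proj₁ P′ ≡ q → InProduct p q P P′ Q → Q ∈ basisMul P P′
  InProduct⇒∈-basisMul (zero , x) (p′ , x′) {_ , w} ≡.refl ≡.refl (≡.refl , eq) = here (≡.cong (p′ ,_) (≡.trans (≡.sym (∅-idˡ w))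
    (≡.trans (≡.cong (_· w) (≡.sym (att-triv p′))) (≡.trans (ES-injective (≡.trans (≡.sym (mulES-diag p′ _ w)) eq)) (j-triv p′ x′)))))
  InProduct⇒∈-basisMul (suc g , x) (zero , _) ≡.refl ≡.refl (dims≡ , eq) =
    InProduct⇒∈-single g x (suc g + 0) (≡.sym (ℕ.+-identityʳ (suc g))) dims≡ eq
  InProduct⇒∈-basisMul (suc g , x) (suc g′ , x′) {_ , w} ≡.refl ≡.refl (≡.refl , eq) =
    ∈-basisMul⁺ g g′ x x′ w (ES-injective (≡.trans (≡.sym (mulES-diag _ _ w)) eq))

  atomT : ∀ {k} → S k → List (T k)
  atomT K with rank K ℕ.≟ 1
  ... | yes rK = [ tK K rK ]
  ... | no _   = []

  tBs : ∀ k → List (T k)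
  tBs zero    = []
  tBs (suc k) = [ tB (s≤s z≤n) ]

  allT : ∀ k → List (T k)
  allT k = tb ∷ (tBs k ++ concatMap atomT (elems k))

  _≟T_ : ∀ {k} → DecidableEquality (T k)
  tK K rK ≟T tK K′ rK′ with K ≟ K′
  ... | yes ≡.refl = yes (≡.cong (tK K) (ℕ.≡-irrelevant rK rK′))
  ... | no K≢K′    = no (λ { ≡.refl → K≢K′ ≡.refl })
  tK _ _ ≟T tb     = no (λ ())
  tK _ _ ≟T tB _   = no (λ ())
  tb     ≟T tK _ _ = no (λ ())
  tb     ≟T tb     = yes ≡.refl
  tb     ≟T tB _   = no (λ ())
  tB _   ≟T tK _ _ = no (λ ())
  tB _   ≟T tb     = no (λ ())
  tB p   ≟T tB p′  = yes (≡.cong tB (ℕ.≤-irrelevant p p′))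

  private
    atomT-∋ : ∀ {k} (K : S k) (rK : rank K ≡ 1) → tK K rK ∈ atomT K
    atomT-∋ K rK with rank K ℕ.≟ 1
    ... | yes rK′ = here (≡.cong (tK K) (ℕ.≡-irrelevant rK rK′))
    ... | no ¬rK  = ⊥-elim (¬rK rK)

    atomT-∈ : ∀ {k} (K : S k) {f} → f ∈ atomT K → ∃[ rK ] (f ≡ tK K rK)
    atomT-∈ K f∈ with rank K ℕ.≟ 1
    atomT-∈ K (here ≡.refl) | yes rK = rK , ≡.refl

    atomT-unique : ∀ {k} (K : S k) → Unique (atomT K)
    atomT-unique K with rank K ℕ.≟ 1
    ... | yes _ = [] ∷ []
    ... | no _  = []

    concatAtomT-∈ : ∀ {k} (Ks : List (S k)) {f} → f ∈ concatMap atomT Ks → ∃[ K ] (K ∈ Ks × ∃[ rK ] (f ≡ tK K rK))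
    concatAtomT-∈ Ks f∈ with find (∈-concatMap⁻ atomT {xs = Ks} f∈)
    ... | K , K∈ , f∈′ = K , K∈ , atomT-∈ K f∈′

    concatAtomT-unique : ∀ {k} (Ks : List (S k)) → Unique Ks → Unique (concatMap atomT Ks)
    concatAtomT-unique []       []        = []
    concatAtomT-unique (K ∷ Ks) (K∉ ∷ uKs) = Unique.++⁺ (atomT-unique K) (concatAtomT-unique Ks uKs) disjoint
      where
      disjoint : ∀ {f} → f ∈ atomT K × f ∈ concatMap atomT Ks → ⊥
      disjoint (f∈ , f∈′) with atomT-∈ K f∈ | concatAtomT-∈ Ks f∈′
      ... | _ , ≡.refl | K′ , K′∈ , _ , ≡.refl = All.lookup K∉ K′∈ ≡.refl

  allT-complete : ∀ {k} (f : T k) → f ∈ allT k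
  allT-complete tb           = here ≡.refl
  allT-complete {suc k} (tB p) = there (here (≡.cong tB (ℕ.≤-irrelevant p (s≤s z≤n))))
  allT-complete {k} (tK K rK)  =
    there (∈-++⁺ʳ (tBs k) (∈-concatMap⁺ atomT (Any.map (λ { ≡.refl → atomT-∋ K rK }) (elems-complete K))))

  allT-unique : ∀ k → Unique (allT k)
  allT-unique k = All.tabulate tb∉ ∷ Unique.++⁺ (tBs-unique k) (concatAtomT-unique (elems k) (elems-unique k)) disjoint
    where
    tBs-unique : ∀ k → Unique (tBs k)
    tBs-unique zero    = []
    tBs-unique (suc k) = [] ∷ []
    tBs-∈ : ∀ {k f} → f ∈ tBs k → ∃[ p ] (f ≡ tB p)
    tBs-∈ {suc k} (here f≡) = _ , f≡
    tb∉ : ∀ {f} → f ∈ tBs k ++ concatMap atomT (elems k) → tb ≢ f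
    tb∉ f∈ with ∈-++⁻ (tBs k) f∈
    ... | inj₁ f∈′ with tBs-∈ f∈′
    ...   | _ , ≡.refl = λ ()
    tb∉ f∈ | inj₂ f∈′ with concatAtomT-∈ (elems k) f∈′
    ...   | _ , _ , _ , ≡.refl = λ ()
    disjoint : ∀ {f} → f ∈ tBs k × f ∈ concatMap atomT (elems k) → ⊥
    disjoint (f∈ , f∈′) with tBs-∈ f∈ | concatAtomT-∈ (elems k) f∈′
    ... | _ , ≡.refl | _ , _ , _ , ()

  basisΔ-as-sum-over-T : ∀ k (X : S (suc k)) (φ : ES × ES → Carrier) →
                         sumL φ (basisΔ (suc k , X)) ≈ sumL (λ f → indicator (K_ f ≼? X) *ₖ φ (hat f X)) (allT (suc k))
  basisΔ-as-sum-over-T k X φ = +-cong (sym ∅-term) (+-cong (sym ∅-term) atom-terms)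
    where
    ∅-term : ∀ {t} → indicator (∅ (suc k) ≼? X) *ₖ φ t ≈ φ t
    ∅-term = trans (*-congʳ (indicator-yes (∅ (suc k) ≼? X) (∅≼ X))) (*-identityˡ _)
    term : T (suc k) → Carrier
    term f = indicator (K_ f ≼? X) *ₖ φ (hat f X)
    per-element : ∀ K → sumL term (atomT K) ≈ indicator ((rank K ℕ.≟ 1) ×-dec (K ≼? X)) *ₖ φ (toPair (b K X))
    per-element K with rank K ℕ.≟ 1
    ... | no _ = sym (zeroˡ _)
    ... | yes _ with K ≼? X
    ...   | yes K≼X = trans (+-identityʳ _) (*-congˡ (reflexive (≡.cong (λ t → φ (toPair (b K t))) K≼X)))
    ...   | no _    = trans (+-identityʳ _) (trans (zeroˡ _) (sym (zeroˡ _)))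
    atom-terms : sumL φ (atomTerms X) ≈ sumL term (concatMap atomT (elems (suc k)))
    atom-terms = begin
      sumL φ (atomTerms X)                                ≡⟨ sumL-map φ (λ K → toPair (b K X)) (atomsBelow X) ⟩
      sumL (λ K → φ (toPair (b K X))) (atomsBelow X)       ≈⟨ sumL-filter (λ K → (rank K ℕ.≟ 1) ×-dec (K ≼? X)) _ (elems (suc k)) ⟩
      sumL (λ K → indicator ((rank K ℕ.≟ 1) ×-dec (K ≼? X)) *ₖ φ (toPair (b K X))) (elems (suc k))
                                                          ≈⟨ sym (sumL-cong (elems (suc k)) per-element) ⟩
      sumL (λ K → sumL term (atomT K)) (elems (suc k))     ≈⟨ sym (sumL-concatMap term atomT (elems (suc k))) ⟩
      sumL term (concatMap atomT (elems (suc k)))          ∎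

  -- By (B1), h = g(f, f′) runs over T^{n+m} as (f, f′) runs over T^n × T^m.
  -- By (B2) and (CP), ĥ maps the Z ≥ K_h with G_{n,m} Z = j(x × y) bijectively
  -- onto the pairs of terms of M_{P₁} * M_{P₁′} and M_{P₂} * M_{P₂′}, where
  -- f̂(x) = (P₁ , P₂) and f̂′(y) = (P₁′ , P₂′); unless K_f ≤ x and K_{f′} ≤ y
  -- there is no such Z.
  module ΔMul (bax : BAxioms D) (n′ m′ : ℕ) (x : S (suc n′)) (y : S (suc m′)) (Tg : ES × ES) where
    open BAxioms bax using (B1-dims; B1-K; B2) renaming (g to gT)

    n m : ℕ
    n = suc n′
    m = suc m′

    g-pair : T n × T m → T (n + m)
    g-pair (f , f′) = app (gT n m) f f′

    G J : S (n + m)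
    G = Gab n m
    J = proj₂ (jPair (n , x) (m , y))

    support : List (S (n + m))
    support = filter (λ Z → (G · Z) ≟ J) (elems (n + m))

    Λ : T (n + m) → Carrier
    Λ h = sumL (λ Z → indicator (K_ h ≼? Z) *ₖ δ₂ (hat h Z) Tg) support

    Ψ : T n → T m → Carrier
    Ψ f f′ = sumL (λ H₁ → sumL (λ H₂ → δ₂ (H₁ , H₂) Tg) (basisMul (proj₂ (hat f x)) (proj₂ (hat f′ y))))
                  (basisMul (proj₁ (hat f x)) (proj₁ (hat f′ y)))

    jPair-≼⁻ : ∀ {u u′ : S n} {v v′ : S m} → proj₂ (jPair (n , u) (m , v)) ≼ proj₂ (jPair (n , u′) (m , v′)) → u ≼ u′ × v ≼ v′
    jPair-≼⁻ le = pair-≼*⁻ (Equivalence.from (j-order (n + m) (n ∷ m ∷ []) (composition-pair n′ m′) _ _ ≡.refl ≡.refl) le)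

    jPair-≼⁺ : ∀ {u u′ : S n} {v v′ : S m} → u ≼ u′ → v ≼ v′ → proj₂ (jPair (n , u) (m , v)) ≼ proj₂ (jPair (n , u′) (m , v′))
    jPair-≼⁺ p q = Equivalence.to (j-order (n + m) (n ∷ m ∷ []) (composition-pair n′ m′) _ _ ≡.refl ≡.refl) (pair-≼*⁺ p q)

    support⁻ : ∀ {Z} → Z ∈ support → G · Z ≡ J
    support⁻ Z∈ = proj₂ (∈-filter⁻ (λ Z → (G · Z) ≟ J) {xs = elems (n + m)} Z∈)

    module Term (f : T n) (f′ : T m) where
      h : T (n + m)
      h = g-pair (f , f′)

      n₁ n₂ m₁ m₂ : ℕ
      n₁ = proj₁ (dims f)
      n₂ = proj₂ (dims f)
      m₁ = proj₁ (dims f′)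
      m₂ = proj₂ (dims f′)

      P₁ P₂ P₁′ P₂′ : ES
      P₁  = proj₁ (hat f x)
      P₂  = proj₂ (hat f x)
      P₁′ = proj₁ (hat f′ y)
      P₂′ = proj₂ (hat f′ y)

      G·Kh : G · K_ h ≡ proj₂ (jPair (n , K_ f) (m , K_ f′))
      G·Kh = ES-injective (B1-K n m f f′)

      Λ-vanishes : ¬ (K_ f ≼ x × K_ f′ ≼ y) → Λ h ≈ 0#
      Λ-vanishes ¬below = sumL-zero _ support (λ Z Z∈ →
        trans (*-congʳ (indicator-no (K_ h ≼? Z) (λ Kh≼Z → ¬below (jPair-≼⁻ (≡.subst₂ _≼_ G·Kh (support⁻ Z∈) (·-monoʳ-≼ G Kh≼Z))))))
              (zeroˡ _))

      hat-G : hat h G ≡ ((n₁ + m₁ , Gab n₁ m₁) , (n₂ + m₂ , Gab n₂ m₂))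
      hat-G = ≡.trans (≡.cong (hat h) (≡.sym (ES-injective (jPair-bot n m)))) (≡.trans (B2 n m f f′ (∅ n) (∅ m))
                (≡.trans (≡.cong₂ (λ p q → (jPair (proj₁ p) (proj₁ q) , jPair (proj₂ p) (proj₂ q))) (hat-∅ f) (hat-∅ f′))
                         (≡.cong₂ _,_ (jPair-bot n₁ m₁) (jPair-bot n₂ m₂))))

      hat-J : hat h J ≡ (jPair P₁ P₁′ , jPair P₂ P₂′)
      hat-J = B2 n m f f′ x y

      hat-G· : ∀ Z → hat h (G · Z) ≡ ((n₁ + m₁ , Gab n₁ m₁) , (n₂ + m₂ , Gab n₂ m₂)) ·² hat h Z
      hat-G· Z = ≡.trans (hat-· h G Z) (≡.cong (_·² hat h Z) hat-G)

      module Below (Kf≼x : K_ f ≼ x) (Kf′≼y : K_ f′ ≼ y) where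
        dims-P : (proj₁ P₁ , proj₁ P₂) ≡ (n₁ , n₂)
        dims-P = hat-dims f Kf≼x

        dims-P′ : (proj₁ P₁′ , proj₁ P₂′) ≡ (m₁ , m₂)
        dims-P′ = hat-dims f′ Kf′≼y

        into : ∀ Z → K_ h ≼ Z → G · Z ≡ J → proj₁ (hat h Z) ∈ basisMul P₁ P₁′ × proj₂ (hat h Z) ∈ basisMul P₂ P₂′
        into Z Kh≼Z GZ≡J =
          InProduct⇒∈-basisMul P₁ P₁′ (≡.cong proj₁ dims-P) (≡.cong proj₁ dims-P′) (≡.cong proj₁ dims-Z , ≡.cong proj₁ products) ,
          InProduct⇒∈-basisMul P₂ P₂′ (≡.cong proj₂ dims-P) (≡.cong proj₂ dims-P′) (≡.cong proj₂ dims-Z , ≡.cong proj₂ products)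
          where
          products : ((n₁ + m₁ , Gab n₁ m₁) , (n₂ + m₂ , Gab n₂ m₂)) ·² hat h Z ≡ (jPair P₁ P₁′ , jPair P₂ P₂′)
          products = ≡.trans (≡.sym (hat-G· Z)) (≡.trans (≡.cong (hat h) GZ≡J) hat-J)
          dims-Z : (proj₁ (proj₁ (hat h Z)) , proj₁ (proj₂ (hat h Z))) ≡ (n₁ + m₁ , n₂ + m₂)
          dims-Z = ≡.trans (hat-dims h Kh≼Z) (B1-dims n m f f′)

        onto : ∀ Q₁ Q₂ → Q₁ ∈ basisMul P₁ P₁′ → Q₂ ∈ basisMul P₂ P₂′ →
               ∃[ Z ] (K_ h ≼ Z × G · Z ≡ J × hat h Z ≡ (Q₁ , Q₂))
        onto Q₁ Q₂ Q₁∈ Q₂∈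
          with ∈-basisMul⇒InProduct P₁ P₁′ (≡.cong proj₁ dims-P) (≡.cong proj₁ dims-P′) Q₁∈
             | ∈-basisMul⇒InProduct P₂ P₂′ (≡.cong proj₂ dims-P) (≡.cong proj₂ dims-P′) Q₂∈
        ... | d₁ , e₁ | d₂ , e₂ with hat-surjective h Q₁ Q₂ (≡.trans (≡.cong₂ _,_ d₁ d₂) (≡.sym (B1-dims n m f f′)))
        ...   | Z , Kh≼Z , hZ≡ = Z , Kh≼Z , GZ≡J , hZ≡
          where
          Kh·GZ≡Kh·J : K_ h · (G · Z) ≡ K_ h · J
          Kh·GZ≡Kh·J = hat-injective h (≼-· (K_ h) _) (≼-· (K_ h) J)
            (≡.trans (hat-K· h (G · Z)) (≡.trans (hat-G· Z) (≡.trans (≡.cong (_ ·²_) hZ≡)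
              (≡.trans (≡.cong₂ _,_ e₁ e₂) (≡.trans (≡.sym hat-J) (≡.sym (hat-K· h J)))))))
          G·Kh≼J : (G · K_ h) ≼ J
          G·Kh≼J = ≡.subst (_≼ J) (≡.sym G·Kh) (jPair-≼⁺ Kf≼x Kf′≼y)
          GZ≡J : G · Z ≡ J
          GZ≡J = G·≡-from-K·≡ Kh≼Z G·Kh≼J Kh·GZ≡Kh·J

        Λ≈Ψ : Λ h ≈ Ψ f f′
        Λ≈Ψ = begin
          Λ h ≈⟨ sym (sumL-filter (K_ h ≼?_) (λ Z → δ₂ (hat h Z) Tg) support) ⟩
          sumL (λ Z → δ₂ (hat h Z) Tg) (filter (K_ h ≼?_) support)
            ≈⟨ sumL-bijection _≟ES²_ (λ p → δ₂ p Tg) (hat h)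
                 (Unique.filter⁺ _ (Unique.filter⁺ _ (elems-unique (n + m))))
                 (pairs-unique (basisMul P₁ P₁′) _ (basisMul-unique P₁ P₁′) (λ _ → basisMul-unique P₂ P₂′))
                 (λ Z Z∈ → let (Z∈′ , Kh≼Z) = ∈-filter⁻ (K_ h ≼?_) {xs = support} Z∈
                               (Q₁∈ , Q₂∈) = into Z Kh≼Z (support⁻ Z∈′)
                           in pairs-∈⁺ (basisMul P₁ P₁′) (λ _ → basisMul P₂ P₂′) Q₁∈ Q₂∈)
                 (λ Q Q∈ → let (Q₁∈ , Q₂∈) = pairs-∈⁻ (basisMul P₁ P₁′) (λ _ → basisMul P₂ P₂′) Q∈
                               (Z , Kh≼Z , GZ≡J , hZ≡) = onto (proj₁ Q) (proj₂ Q) Q₁∈ Q₂∈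
                           in Z , ∈-filter⁺ (K_ h ≼?_) (∈-filter⁺ (λ Z → (G · Z) ≟ J) (elems-complete Z) GZ≡J) Kh≼Z , hZ≡)
                 (λ Z Z′ Z∈ Z′∈ → hat-injective h (proj₂ (∈-filter⁻ (K_ h ≼?_) {xs = support} Z∈))
                                                  (proj₂ (∈-filter⁻ (K_ h ≼?_) {xs = support} Z′∈))) ⟩
          sumL (λ p → δ₂ p Tg) (pairs (basisMul P₁ P₁′) (λ _ → basisMul P₂ P₂′))
            ≈⟨ sumL-pairs (λ p → δ₂ p Tg) (basisMul P₁ P₁′) (λ _ → basisMul P₂ P₂′) ⟩
          Ψ f f′ ∎

      Λ≈ : Λ h ≈ indicator (K_ f ≼? x) *ₖ (indicator (K_ f′ ≼? y) *ₖ Ψ f f′)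
      Λ≈ with K_ f ≼? x | K_ f′ ≼? y
      ... | yes Kf≼x | yes Kf′≼y = trans (Below.Λ≈Ψ Kf≼x Kf′≼y) (sym (trans (*-identityˡ _) (*-identityˡ _)))
      ... | yes _    | no Kf′⋠y  = trans (Λ-vanishes (Kf′⋠y ∘ proj₂)) (sym (trans (*-identityˡ _) (zeroˡ _)))
      ... | no Kf⋠x  | _         = trans (Λ-vanishes (Kf⋠x ∘ proj₁)) (sym (zeroˡ _))

    coefficients-agree :
      sumL (λ H → sumL (λ t → δ₂ t Tg) (basisΔ H)) (basisMul (n , x) (m , y)) ≈
      sumL (λ s → sumL (λ s′ → sumL (λ H₁ → sumL (λ H₂ → δ₂ (H₁ , H₂) Tg) (basisMul (proj₂ s) (proj₂ s′)))
                                    (basisMul (proj₁ s) (proj₁ s′))) (basisΔ (m , y))) (basisΔ (n , x))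
    coefficients-agree = begin
      sumL (λ H → sumL (λ t → δ₂ t Tg) (basisΔ H)) (map (n + m ,_) support)
        ≡⟨ sumL-map (λ H → sumL (λ t → δ₂ t Tg) (basisΔ H)) (n + m ,_) support ⟩
      sumL (λ Z → sumL (λ t → δ₂ t Tg) (basisΔ (n + m , Z))) support
        ≈⟨ sumL-cong support (λ Z → basisΔ-as-sum-over-T (n′ + m) Z (λ t → δ₂ t Tg)) ⟩
      sumL (λ Z → sumL (λ h → indicator (K_ h ≼? Z) *ₖ δ₂ (hat h Z) Tg) (allT (n + m))) support
        ≈⟨ sumL-swap (λ Z h → indicator (K_ h ≼? Z) *ₖ δ₂ (hat h Z) Tg) support (allT (n + m)) ⟩
      sumL Λ (allT (n + m))
        ≈⟨ sym (sumL-bijection _≟T_ Λ g-pair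
                 (pairs-unique (allT n) (λ _ → allT m) (allT-unique n) (λ _ → allT-unique m)) (allT-unique (n + m))
                 (λ i _ → allT-complete (g-pair i))
                 (λ h _ → let (i , g-pair-i≡h) = Bijection.surjective (gT n m) h
                          in i , pairs-∈⁺ (allT n) (λ _ → allT m) (allT-complete (proj₁ i)) (allT-complete (proj₂ i)) , g-pair-i≡h ≡.refl)
                 (λ i i′ _ _ → Bijection.injective (gT n m))) ⟩
      sumL (Λ ∘ g-pair) (pairs (allT n) (λ _ → allT m))
        ≈⟨ sumL-cong (pairs (allT n) (λ _ → allT m)) (λ i → Term.Λ≈ (proj₁ i) (proj₂ i)) ⟩
      sumL (λ i → indicator (K_ (proj₁ i) ≼? x) *ₖ (indicator (K_ (proj₂ i) ≼? y) *ₖ Ψ (proj₁ i) (proj₂ i)))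
           (pairs (allT n) (λ _ → allT m))
        ≈⟨ sumL-pairs _ (allT n) (λ _ → allT m) ⟩
      sumL (λ f → sumL (λ f′ → indicator (K_ f ≼? x) *ₖ (indicator (K_ f′ ≼? y) *ₖ Ψ f f′)) (allT m)) (allT n)
        ≈⟨ sumL-cong (allT n) (λ f → trans (sym (sumL-*ˡ (indicator (K_ f ≼? x)) _ (allT m)))
             (*-congˡ (sym (basisΔ-as-sum-over-T m′ y (λ s′ → sumL (λ H₁ → sumL (λ H₂ → δ₂ (H₁ , H₂) Tg)
                 (basisMul (proj₂ (hat f x)) (proj₂ s′))) (basisMul (proj₁ (hat f x)) (proj₁ s′))))))) ⟩
      sumL (λ f → indicator (K_ f ≼? x) *ₖ
                  sumL (λ s′ → sumL (λ H₁ → sumL (λ H₂ → δ₂ (H₁ , H₂) Tg) (basisMul (proj₂ (hat f x)) (proj₂ s′)))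
                                    (basisMul (proj₁ (hat f x)) (proj₁ s′))) (basisΔ (m , y))) (allT n)
        ≈⟨ sym (basisΔ-as-sum-over-T n′ x (λ s → sumL (λ s′ → sumL (λ H₁ → sumL (λ H₂ → δ₂ (H₁ , H₂) Tg)
                 (basisMul (proj₂ s) (proj₂ s′))) (basisMul (proj₁ s) (proj₁ s′))) (basisΔ (m , y)))) ⟩
      sumL (λ s → sumL (λ s′ → sumL (λ H₁ → sumL (λ H₂ → δ₂ (H₁ , H₂) Tg) (basisMul (proj₂ s) (proj₂ s′)))
                                    (basisMul (proj₁ s) (proj₁ s′))) (basisΔ (m , y))) (basisΔ (n , x)) ∎

  basisΔ-mul : BAxioms D → BasisΔMul
  basisΔ-mul bax (zero , _) G Tg =
    trans (+-identityʳ _) (sym (trans (+-identityʳ _) (sumL-cong (basisΔ G) (λ s′ → trans (+-identityʳ _) (+-identityʳ _)))))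
  basisΔ-mul bax F@(suc _ , _) (zero , _) Tg = trans (+-identityʳ _) (sym (sumL-cong (basisΔ F) (λ s →
    trans (+-identityʳ _) (trans (reflexive (≡.cong₂ (λ p q → sumL (λ H₁ → sumL (λ H₂ → δ₂ (H₁ , H₂) Tg) q) p)
                                                      (basisMul-unitʳ (proj₁ s)) (basisMul-unitʳ (proj₂ s))))
                                 (trans (+-identityʳ _) (+-identityʳ _))))))
  basisΔ-mul bax (suc n′ , x) (suc m′ , y) Tg = ΔMul.coefficients-agree bax n′ m′ x y Tg

mainTheorem2 : ∀ {c ℓ : Level} (𝕂 : Char0Field c ℓ) (D : LRBData) →
    Axioms D → BAxioms D → Hopf.IsBialgebra 𝕂 D
mainTheorem2 𝕂 D ax bax = record
  { mul-assoc = mul-assoc basisMul-assoc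
  ; mul-unitˡ = mul-unitˡ
  ; mul-unitʳ = mul-unitʳ basisMul-unitʳ
  ; Δ-coassoc = Δ-coassoc basis-coassoc
  ; ε-counitˡ = ε-counitˡ basis-counitˡ
  ; ε-counitʳ = ε-counitʳ basis-counitʳ
  ; Δ-mul     = Δ-mul (basisΔ-mul bax)
  ; Δ-one     = Δ-one
  ; ε-mul     = ε-mul basisε-mul
  ; ε-one     = ε-one
  }
  where
  open Coefficients 𝕂 D
  open BasisIdentities 𝕂 D ax
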